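{- Let $\Gamma$ be a weighted digraph with Laplacian matrix $L$, numbers $\sigma_i$ and matrices $Q_k$ as in the context. Define $\alpha_0=1$ and, for $k\ge1$, $$\alpha_k=\sum_{(p_1,\dots,p_k)}(-1)^{\sum_{i=1}^k p_i}\,\frac{\left(\sum_{i=1}^k p_i\right)!}{\prod_{i=1}^k (p_i!)}\,\prod_{i=1}^k\sigma_i^{p_i},$$ where the sum is over all $k$-tuples of nonnegative integers $(p_1,\dots,p_k)$ with $\sum_{i=1}^k i\,p_i=k$. Then for every $m=0,1,2,\dots$, $$(-L)^m=\sum_{k=0}^{m}\alpha_kQ_{m-k}.$$
   Context: $\Gamma$ is a weighted digraph without loops on vertex set $\{1,\dots,n\}$, $n>1$, with strictly positive arc weights $w_{ij}$ ($w_{ij}=0$ if there is no arc $i\to j$). Its Laplacian $L=(\ell_{ij})$ has $\ell_{ij}=-w_{ij}$ for $j\ne i$, $\ell_{ii}=\sum_{k\ne i}w_{ik}$. The weight of a subgraph is the product of its arc weights (1 if no arcs); the weight of a set of subgraphs is the sum of their weights (0 if empty). A converging tree is a weakly connected digraph in which one vertex (the root) has outdegree 0 and all others outdegree 1; an in-forest of $\Gamma$ is a spanning subgraph all of whose weak components are converging trees. For $k\ge0$, $\sigma_k$ is the total weight of in-forests of $\Gamma$ with $k$ arcs (so $\sigma_k=0$ for large $k$), and $Q_k=(q^k_{ij})$ where $q^k_{ij}$ is the total weight of in-forests of $\Gamma$ with $k$ arcs in which $i$ belongs to the tree rooted at $j$. -}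

module Defs where

open import Algebra.Bundles using (CommutativeRing)
open import Data.Nat as ℕ using (ℕ; zero; suc; _∸_; NonZero; _!; _≡ᵇ_; _≤ᵇ_)
open import Data.Nat.Properties using (m*n≢0; _!≢0)
open import Data.Bool using (Bool; true; false; _∧_; _∨_; not; if_then_else_)
open import Data.Fin as Fin using (Fin; toℕ)
open import Data.List using (List; []; _∷_; map; concatMap; foldr; filterᵇ; upTo)
open import Relation.Nullary.Decidable using (⌊_⌋)
open import Relation.Binary.PropositionalEquality using (_≡_)

allFuns : ∀ {a} {A : Set a} → List A → (m : ℕ) → List (Fin m → A)
allFuns xs zero    = (λ ()) ∷ []
allFuns xs (suc m) =
  concatMap (λ x → map (λ f → λ { Fin.zero → x ; (Fin.suc i) → f i }) (allFuns xs m)) xs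

allB : (m : ℕ) → (Fin m → Bool) → Bool
allB zero    f = true
allB (suc m) f = f Fin.zero ∧ allB m (λ i → f (Fin.suc i))

anyB : (m : ℕ) → (Fin m → Bool) → Bool
anyB zero    f = false
anyB (suc m) f = f Fin.zero ∨ anyB m (λ i → f (Fin.suc i))

sumℕ : (m : ℕ) → (Fin m → ℕ) → ℕ
sumℕ zero    f = 0
sumℕ (suc m) f = f Fin.zero ℕ.+ sumℕ m (λ i → f (Fin.suc i))

prodFact : (m : ℕ) → (Fin m → ℕ) → ℕ
prodFact zero    p = 1
prodFact (suc m) p = (p Fin.zero) ! ℕ.* prodFact m (λ i → p (Fin.suc i))

prodFact-nz : (m : ℕ) (p : Fin m → ℕ) → NonZero (prodFact m p)
prodFact-nz zero    p = _
prodFact-nz (suc m) p =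
  m*n≢0 ((p Fin.zero) !) (prodFact m (λ i → p (Fin.suc i)))
    {{(p Fin.zero) !≢0}} {{prodFact-nz m (λ i → p (Fin.suc i))}}

multinomial : (m : ℕ) → (Fin m → ℕ) → ℕ
multinomial m p = ℕ._/_ (sumℕ m p !) (prodFact m p) {{prodFact-nz m p}}

_==_ : ∀ {n} → Fin n → Fin n → Bool
i == j = ⌊ i Fin.≟ j ⌋

-- a spanning subgraph: S i j = true iff the arc i → j is present
Subgraph : ℕ → Set
Subgraph n = Fin n → Fin n → Bool

outdeg : ∀ {n} → Subgraph n → Fin n → ℕ
outdeg {n} S i = sumℕ n (λ j → if S i j then 1 else 0)

numArcs : ∀ {n} → Subgraph n → ℕ
numArcs {n} S = sumℕ n (outdeg S)

reach : ∀ {n} → Subgraph n → ℕ → Fin n → Fin n → Bool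
reach S zero    i j = i == j
reach {n} S (suc t) i j =
  reach S t i j ∨ anyB n (λ l → reach S t i l ∧ (S l j ∨ S j l))

-- i and j lie in the same weak component of S
-- (on n vertices, walks of length ≤ n suffice)
sameComponent : ∀ {n} → Subgraph n → Fin n → Fin n → Bool
sameComponent {n} S = reach S n

isRootOf : ∀ {n} → Subgraph n → Fin n → Fin n → Bool
isRootOf S i r = sameComponent S i r ∧ (outdeg S r ≡ᵇ 0)

-- every weak component is a converging tree: every vertex has outdegree ≤ 1
-- and every weak component contains exactly one vertex of outdegree 0
isInForest : ∀ {n} → Subgraph n → Bool
isInForest {n} S =
  allB n (λ i → outdeg S i ≤ᵇ 1) ∧
  allB n (λ i → sumℕ n (λ r → if isRootOf S i r then 1 else 0) ≡ᵇ 1)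

module _ {c ℓ} (R : CommutativeRing c ℓ) where
  open CommutativeRing R

  record WDigraph (n : ℕ) : Set c where
    field
      arc      : Fin n → Fin n → Bool
      loopless : ∀ i → arc i i ≡ false
      weight   : Fin n → Fin n → Carrier

  Matrix : ℕ → Set c
  Matrix n = Fin n → Fin n → Carrier

  sumR : (m : ℕ) → (Fin m → Carrier) → Carrier
  sumR zero    f = 0#
  sumR (suc m) f = f Fin.zero + sumR m (λ i → f (Fin.suc i))

  prodR : (m : ℕ) → (Fin m → Carrier) → Carrier
  prodR zero    f = 1#
  prodR (suc m) f = f Fin.zero * prodR m (λ i → f (Fin.suc i))

  sumList : List Carrier → Carrier
  sumList = foldr _+_ 0#

  fromℕ : ℕ → Carrier
  fromℕ zero    = 0#
  fromℕ (suc k) = 1# + fromℕ k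

  pow : Carrier → ℕ → Carrier
  pow x zero    = 1#
  pow x (suc k) = x * pow x k

  idM : ∀ {n} → Matrix n
  idM i j = if i == j then 1# else 0#

  mulM : ∀ {n} → Matrix n → Matrix n → Matrix n
  mulM {n} A B i j = sumR n (λ k → A i k * B k j)

  powM : ∀ {n} → Matrix n → ℕ → Matrix n
  powM A zero    = idM
  powM A (suc m) = mulM A (powM A m)

  negM : ∀ {n} → Matrix n → Matrix n
  negM A i j = - A i j

  module _ {n : ℕ} (Γ : WDigraph n) where
    open WDigraph Γ

    w : Fin n → Fin n → Carrier
    w i j = if arc i j then weight i j else 0#

    laplacian : Matrix n
    laplacian i j =
      if i == j then sumR n (λ k → if k == i then 0# else w i k) else - w i j

    isSubgraphOfΓ : Subgraph n → Bool
    isSubgraphOfΓ S = allB n (λ i → allB n (λ j → not (S i j) ∨ arc i j))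

    subgraphs : List (Subgraph n)
    subgraphs = filterᵇ isSubgraphOfΓ (allFuns (allFuns (true ∷ false ∷ []) n) n)

    subgraphWeight : Subgraph n → Carrier
    subgraphWeight S = prodR n (λ i → prodR n (λ j → if S i j then w i j else 1#))

    σ : ℕ → Carrier
    σ k = sumList (map (λ S → if isInForest S ∧ (numArcs S ≡ᵇ k)
                               then subgraphWeight S else 0#) subgraphs)

    Q : ℕ → Matrix n
    Q k i j = sumList (map (λ S → if isInForest S ∧ (numArcs S ≡ᵇ k) ∧ isRootOf S i j
                                   then subgraphWeight S else 0#) subgraphs)

    -- k-tuples (p₁,…,pₖ) (p indexed by Fin k, p i = p_{i+1}) of naturals
    -- with Σ i·pᵢ = k  (each pᵢ ≤ k necessarily)
    tuples : (k : ℕ) → List (Fin k → ℕ)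
    tuples k = filterᵇ (λ p → sumℕ k (λ i → suc (toℕ i) ℕ.* p i) ≡ᵇ k)
                       (allFuns (upTo (suc k)) k)

    αterm : (k : ℕ) → (Fin k → ℕ) → Carrier
    αterm k p = pow (- 1#) (sumℕ k p) * fromℕ (multinomial k p)
                * prodR k (λ i → pow (σ (suc (toℕ i))) (p i))

    α : ℕ → Carrier
    α zero    = 1#
    α (suc k) = sumList (map (αterm (suc k)) (tuples (suc k)))

module Submission where

-- With A = -L, the matrices Q k satisfy Q 0 = I and Q (k + 1) = σ (k + 1) I + A Q k, while
-- α (m + 1) = - Σ_{k ≤ m} α k σ (m + 1 - k); induction on m then gives A^m = Σ_{k ≤ m} α k Q (m - k).
--
-- For the recurrence of Q, encode an in-forest by the map sending each vertex to its out-neighbour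
-- (nothing at a root), and group these maps by their values away from a vertex i. In a group,
-- either i is a root, or i points to some a; this is a forest exactly when a lies outside the tree
-- of i, and then the vertices of that tree are re-rooted at the root of a. Summed over a, the
-- identity Q (k + 1) + L Q k = σ (k + 1) I reduces to (L c) i = Σ_l w i l (c i - c l) for the
-- indicator vectors c of the root maps.
--
-- The recurrence of α is Pascal's rule for multinomial coefficients: removing a part t + 1 from a
-- partition of m + 1 leaves a partition of m - t and contributes the factor -σ (t + 1).

open import Defs
open import Algebra.Bundles using (CommutativeRing)
open import Data.Nat using (ℕ; suc; _∸_; _≤_)
open import Data.Fin using (Fin; toℕ)

open import Data.Bool using (Bool; true; false; _∧_; _∨_; not; if_then_else_; T)
import Data.Bool.Properties as Boolₚ
open import Data.Empty using (⊥-elim)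
open import Data.Fin as Fin using (punchIn)
open import Data.Fin.Permutation using (Permutation′; permutation)
import Data.Fin.Properties as Finₚ
open import Data.List using (List; []; _∷_; map; concatMap; filterᵇ; tabulate; _++_; upTo; allFin)
import Data.List.Properties as Listₚ
open import Data.Maybe using (Maybe; just; nothing; fromMaybe; maybe′; is-just; is-nothing)
import Data.Nat as ℕ
open import Data.Nat using (NonZero)
open import Data.Nat.Combinatorics using (k![n∸k]!∣n!)
open import Data.Nat.Divisibility using (_∣_; ∣-refl; ∣-trans; *-monoʳ-∣)
open import Data.Nat.DivMod using (m/n*n≡m)
import Data.Nat.Properties as ℕₚ
open import Data.Product using (Σ; _×_; _,_; proj₁; proj₂)
open import Data.Sum using (_⊎_; inj₁; inj₂)
open import Data.Vec.Functional as Vec using (Vector) renaming (_∷_ to _∷ᵥ_; [] to []ᵥ)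
import Data.Vec.Functional.Properties as Vecₚ
open import Function using (_∘_; _⇔_; mk⇔; Equivalence)
open import Function.Properties.Equivalence using () renaming (refl to ⇔-refl; sym to ⇔-sym; trans to ⇔-trans)
open import Level using (Level)
open import Relation.Binary.PropositionalEquality as ≡ using (_≡_; _≢_; refl)
open import Relation.Nullary using (Dec; yes; no)
open import Relation.Nullary.Decidable using (isYes≗does; dec-true; dec-false; toWitness; ⌊⌋-map′)

open import Algebra.Properties.CommutativeSemigroup ℕₚ.+-commutativeSemigroup using ()
  renaming (x∙yz≈y∙xz to x+yz≡y+xz; xy∙z≈yz∙x to xy+z≡yz+x)
open import Algebra.Properties.CommutativeSemigroup ℕₚ.*-commutativeSemigroup using ()
  renaming (x∙yz≈y∙xz to x*yz≡y*xz)

private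
  variable
    a b : Level
    A : Set a
    B : Set b

T⇒≡ : ∀ {b} → T b → b ≡ true
T⇒≡ = Equivalence.to Boolₚ.T-≡

≡⇒T : ∀ {b} → b ≡ true → T b
≡⇒T = Equivalence.from Boolₚ.T-≡

==-≡ : ∀ {n} {i j : Fin n} → i ≡ j → (i == j) ≡ true
==-≡ {i = i} {j} = ≡.trans (isYes≗does (i Fin.≟ j)) ∘ dec-true (i Fin.≟ j)

==-≢ : ∀ {n} {i j : Fin n} → i ≢ j → (i == j) ≡ false
==-≢ {i = i} {j} = ≡.trans (isYes≗does (i Fin.≟ j)) ∘ dec-false (i Fin.≟ j)

==-refl : ∀ {n} (i : Fin n) → (i == i) ≡ true
==-refl i = ==-≡ refl

==⇒≡ : ∀ {n} {i j : Fin n} → (i == j) ≡ true → i ≡ j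
==⇒≡ = toWitness ∘ ≡⇒T

==-suc : ∀ {n} (i j : Fin n) → (Fin.suc i == Fin.suc j) ≡ (i == j)
==-suc i j = ⌊⌋-map′ (≡.cong Fin.suc) Finₚ.suc-injective (i Fin.≟ j)

∧-true : ∀ {a b} → a ≡ true → b ≡ true → (a ∧ b) ≡ true
∧-true refl refl = refl

∧-trueˡ : ∀ a {b} → (a ∧ b) ≡ true → a ≡ true
∧-trueˡ true e = refl

∧-trueʳ : ∀ a {b} → (a ∧ b) ≡ true → b ≡ true
∧-trueʳ true e = e

∨-true : ∀ a {b} → (a ∨ b) ≡ true → a ≡ true ⊎ b ≡ true
∨-true true  e = inj₁ refl
∨-true false e = inj₂ e

∨-trueˡ : ∀ {a} b → a ≡ true → (a ∨ b) ≡ true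
∨-trueˡ b refl = refl

∨-trueʳ : ∀ a {b} → b ≡ true → (a ∨ b) ≡ true
∨-trueʳ true  e = refl
∨-trueʳ false e = e

≡ᵇ-cong : ∀ {a b c d} → (a ≡ b ⇔ c ≡ d) → (a ℕ.≡ᵇ b) ≡ (c ℕ.≡ᵇ d)
≡ᵇ-cong {a} {b} {c} {d} a≡b⇔c≡d with a ℕ.≡ᵇ b in e₁ | c ℕ.≡ᵇ d in e₂
... | true  | true  = refl
... | false | false = refl
... | true  | false with () ← ≡.trans (≡.sym e₂)
  (T⇒≡ (ℕₚ.≡⇒≡ᵇ c d (Equivalence.to a≡b⇔c≡d (ℕₚ.≡ᵇ⇒≡ a b (≡⇒T e₁)))))
... | false | true  with () ← ≡.trans (≡.sym e₁)
  (T⇒≡ (ℕₚ.≡⇒≡ᵇ a b (Equivalence.from a≡b⇔c≡d (ℕₚ.≡ᵇ⇒≡ c d (≡⇒T e₂)))))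

+-≡ᵇ : ∀ x {c K} → c ≤ K → (x ℕ.+ c ℕ.≡ᵇ K) ≡ (x ℕ.≡ᵇ K ∸ c)
+-≡ᵇ x {c} {K} c≤K = ≡ᵇ-cong (mk⇔
  (λ e → ℕₚ.+-cancelʳ-≡ c x (K ∸ c) (≡.trans e (≡.sym (ℕₚ.m∸n+n≡m c≤K))))
  (λ e → ≡.trans (≡.cong (ℕ._+ c) e) (ℕₚ.m∸n+n≡m c≤K)))

allB-true : ∀ m {f : Fin m → Bool} → (∀ i → f i ≡ true) → allB m f ≡ true
allB-true ℕ.zero    h = refl
allB-true (suc m) h = ∧-true (h Fin.zero) (allB-true m (h ∘ Fin.suc))

allB-true⁻ : ∀ m {f : Fin m → Bool} → allB m f ≡ true → ∀ i → f i ≡ true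
allB-true⁻ (suc m) {f} e Fin.zero    = ∧-trueˡ (f Fin.zero) e
allB-true⁻ (suc m) {f} e (Fin.suc i) = allB-true⁻ m (∧-trueʳ (f Fin.zero) e) i

allB-false⁻ : ∀ m {f : Fin m → Bool} → allB m f ≡ false → Σ (Fin m) λ i → f i ≡ false
allB-false⁻ (suc m) {f} e with f Fin.zero in eq
... | false = Fin.zero , eq
... | true  = let i , fi = allB-false⁻ m e in Fin.suc i , fi

allB-cong : ∀ m {f g : Fin m → Bool} → (∀ i → f i ≡ g i) → allB m f ≡ allB m g
allB-cong ℕ.zero    e = refl
allB-cong (suc m) e = ≡.cong₂ _∧_ (e Fin.zero) (allB-cong m (e ∘ Fin.suc))

anyB-true : ∀ m {f : Fin m → Bool} i → f i ≡ true → anyB m f ≡ true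
anyB-true (suc m) Fin.zero        e = ∨-trueˡ _ e
anyB-true (suc m) {f} (Fin.suc i) e = ∨-trueʳ (f Fin.zero) (anyB-true m i e)

anyB-true⁻ : ∀ m {f : Fin m → Bool} → anyB m f ≡ true → Σ (Fin m) λ i → f i ≡ true
anyB-true⁻ (suc m) {f} e with ∨-true (f Fin.zero) e
... | inj₁ e₀ = Fin.zero , e₀
... | inj₂ e₁ = let i , fi = anyB-true⁻ m e₁ in Fin.suc i , fi

anyB-cong : ∀ m {f g : Fin m → Bool} → (∀ i → f i ≡ g i) → anyB m f ≡ anyB m g
anyB-cong ℕ.zero    e = refl
anyB-cong (suc m) e = ≡.cong₂ _∨_ (e Fin.zero) (anyB-cong m (e ∘ Fin.suc))

sumℕ-cong : ∀ m {f g : Fin m → ℕ} → (∀ i → f i ≡ g i) → sumℕ m f ≡ sumℕ m g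
sumℕ-cong ℕ.zero    e = refl
sumℕ-cong (suc m) e = ≡.cong₂ ℕ._+_ (e Fin.zero) (sumℕ-cong m (e ∘ Fin.suc))

sumℕ-zero : ∀ m {f : Fin m → ℕ} → (∀ i → f i ≡ 0) → sumℕ m f ≡ 0
sumℕ-zero ℕ.zero    h = refl
sumℕ-zero (suc m) h = ≡.cong₂ ℕ._+_ (h Fin.zero) (sumℕ-zero m (h ∘ Fin.suc))

sumℕ-zero⁻ : ∀ m (f : Fin m → ℕ) → sumℕ m f ≡ 0 → ∀ i → f i ≡ 0
sumℕ-zero⁻ (suc m) f e Fin.zero    = ℕₚ.m+n≡0⇒m≡0 (f Fin.zero) e
sumℕ-zero⁻ (suc m) f e (Fin.suc i) = sumℕ-zero⁻ m (f ∘ Fin.suc) (ℕₚ.m+n≡0⇒n≡0 (f Fin.zero) e) i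

sumℕ-remove : ∀ m (f : Fin (suc m) → ℕ) i → sumℕ (suc m) f ≡ f i ℕ.+ sumℕ m (f ∘ punchIn i)
sumℕ-remove m       f Fin.zero    = refl
sumℕ-remove (suc m) f (Fin.suc i) = ≡.trans (≡.cong (f Fin.zero ℕ.+_) (sumℕ-remove m (f ∘ Fin.suc) i))
  (x+yz≡y+xz (f Fin.zero) (f (Fin.suc i)) _)

sumℕ-single : ∀ m {f : Fin m → ℕ} i → (∀ j → j ≢ i → f j ≡ 0) → sumℕ m f ≡ f i
sumℕ-single (suc m) {f} i h = ≡.trans (sumℕ-remove m f i)
  (≡.trans (≡.cong (f i ℕ.+_) (sumℕ-zero m (λ j → h (punchIn i j) (Finₚ.punchInᵢ≢i i j)))) (ℕₚ.+-identityʳ (f i)))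

term≤sumℕ : ∀ m (f : Fin m → ℕ) i → f i ≤ sumℕ m f
term≤sumℕ (suc m) f i = ≡.subst (f i ≤_) (≡.sym (sumℕ-remove m f i)) (ℕₚ.m≤m+n (f i) _)

-- Unlike Data.Vec.Functional.insertAt this is built from _∷ᵥ_, so that a
-- sum over a function space can be split along any coordinate without
-- assuming that the summand respects pointwise equality.
insert : ∀ {m} → Fin (suc m) → A → Vector A m → Vector A (suc m)
insert Fin.zero                x f = x ∷ᵥ f
insert {m = suc m} (Fin.suc i) x f = f Fin.zero ∷ᵥ insert i x (f ∘ Fin.suc)

insert-at : ∀ {m} i (x : A) (f : Vector A m) → insert i x f i ≡ x
insert-at Fin.zero                x f = refl
insert-at {m = suc m} (Fin.suc i) x f = insert-at i x (f ∘ Fin.suc)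

insert-punchIn : ∀ {m} i (x : A) (f : Vector A m) k → insert i x f (punchIn i k) ≡ f k
insert-punchIn Fin.zero                x f k           = refl
insert-punchIn {m = suc m} (Fin.suc i) x f Fin.zero    = refl
insert-punchIn {m = suc m} (Fin.suc i) x f (Fin.suc k) = insert-punchIn i x (f ∘ Fin.suc) k

insert-≢ : ∀ {m} i (x y : A) (f : Vector A m) k → k ≢ i → insert i x f k ≡ insert i y f k
insert-≢ Fin.zero                x y f Fin.zero    k≢i = ⊥-elim (k≢i refl)
insert-≢ Fin.zero                x y f (Fin.suc k) k≢i = refl
insert-≢ {m = suc m} (Fin.suc i) x y f Fin.zero    k≢i = refl
insert-≢ {m = suc m} (Fin.suc i) x y f (Fin.suc k) k≢i = insert-≢ i x y (f ∘ Fin.suc) k (k≢i ∘ ≡.cong Fin.suc)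

updateAt-insert : ∀ {m} i (x : A) (h : A → A) (f : Vector A m) k →
  Vec.updateAt (insert i x f) i h k ≡ insert i (h x) f k
updateAt-insert i x h f k with k Fin.≟ i
... | yes refl = ≡.trans (Vecₚ.updateAt-updates i _) (≡.trans (≡.cong h (insert-at i x f)) (≡.sym (insert-at i (h x) f)))
... | no k≢i   = ≡.trans (Vecₚ.updateAt-minimal k i _ k≢i) (insert-≢ i x (h x) f k k≢i)

sumℕ-insert : ∀ m (g : Fin (suc m) → A → ℕ) i x (f : Vector A m) →
  sumℕ (suc m) (λ k → g k (insert i x f k)) ≡ g i x ℕ.+ sumℕ m (λ k → g (punchIn i k) (f k))
sumℕ-insert m g i x f = ≡.trans (sumℕ-remove m (λ k → g k (insert i x f k)) i)
  (≡.cong₂ ℕ._+_ (≡.cong (g i) (insert-at i x f)) (sumℕ-cong m (λ k → ≡.cong (g (punchIn i k)) (insert-punchIn i x f k))))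

-- Functional digraphs and their walks

-- g x = just y is the arc x → y; g x = nothing makes x a root.
FunDigraph : ℕ → Set
FunDigraph n = Vector (Maybe (Fin n)) n

module _ {n : ℕ} where

  step : FunDigraph n → Fin n → Fin n
  step g x = fromMaybe x (g x)

  walk : FunDigraph n → ℕ → Fin n → Fin n
  walk g ℕ.zero    x = x
  walk g (suc t) x = step g (walk g t x)

  step-root : ∀ g {x} → g x ≡ nothing → step g x ≡ x
  step-root g {x} gx = ≡.cong (fromMaybe x) gx

  step-arc : ∀ g {x y} → g x ≡ just y → step g x ≡ y
  step-arc g {x} gx = ≡.cong (fromMaybe x) gx

  walk-root : ∀ g t {r} → g r ≡ nothing → walk g t r ≡ r
  walk-root g ℕ.zero    gr = refl
  walk-root g (suc t) gr = ≡.trans (≡.cong (step g) (walk-root g t gr)) (step-root g gr)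

  walk-+ : ∀ g t u x → walk g (t ℕ.+ u) x ≡ walk g t (walk g u x)
  walk-+ g ℕ.zero    u x = refl
  walk-+ g (suc t) u x = ≡.cong (step g) (walk-+ g t u x)

  walk-suc : ∀ g t x → walk g (suc t) x ≡ walk g t (step g x)
  walk-suc g t x = ≡.trans (≡.cong (λ k → walk g k x) (ℕₚ.+-comm 1 t)) (walk-+ g t 1 x)

  walk-stays : ∀ g t u x → g (walk g t x) ≡ nothing → walk g (u ℕ.+ t) x ≡ walk g t x
  walk-stays g t u x e = ≡.trans (walk-+ g u t x) (walk-root g u e)

  walk-root-unique : ∀ g t t′ x → g (walk g t x) ≡ nothing → g (walk g t′ x) ≡ nothing →
    walk g t x ≡ walk g t′ x
  walk-root-unique g t t′ x e e′ = ≡.trans (≡.sym (walk-stays g t t′ x e))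
    (≡.trans (≡.cong (λ k → walk g k x) (ℕₚ.+-comm t′ t)) (walk-stays g t′ t x e′))

  walk-recurrent : ∀ g x {a b} → a ℕ.< b → walk g a x ≡ walk g b x →
    ∀ t → Σ ℕ λ t′ → t′ ℕ.< b × walk g t x ≡ walk g t′ x
  walk-recurrent g x a<b e ℕ.zero = 0 , ℕₚ.≤-<-trans ℕ.z≤n a<b , refl
  walk-recurrent g x {a} {b} a<b e (suc t) with walk-recurrent g x a<b e t
  ... | t′ , t′<b , eₜ with suc t′ ℕ.≟ b
  ...   | yes t′+1≡b = a , a<b , ≡.trans (≡.cong (step g) eₜ) (≡.trans (≡.cong (λ k → walk g k x) t′+1≡b) (≡.sym e))
  ...   | no  t′+1≢b = suc t′ , ℕₚ.≤∧≢⇒< t′<b t′+1≢b , ≡.cong (step g) eₜ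

  -- Pigeonhole: some vertex repeats among the first n + 1 steps of the walk.
  walk-root-within : ∀ g t x → g (walk g t x) ≡ nothing → g (walk g n x) ≡ nothing
  walk-root-within g t x e
    with a , b , a<b , eₐᵦ ← Finₚ.pigeonhole (ℕₚ.n<1+n n) (λ (k : Fin (suc n)) → walk g (toℕ k) x)
    with t′ , t′<b , eₜ ← walk-recurrent g x a<b eₐᵦ t
    = ≡.trans (≡.cong g (≡.trans (≡.cong (λ k → walk g k x) (≡.sym (ℕₚ.m∸n+n≡m t′≤n)))
                                 (walk-stays g t′ (n ∸ t′) x root′)))
              root′
    where
    t′≤n : t′ ≤ n
    t′≤n = ℕₚ.<⇒≤ (ℕₚ.<-≤-trans t′<b (ℕₚ.≤-pred (Finₚ.toℕ<n b)))
    root′ : g (walk g t′ x) ≡ nothing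
    root′ = ≡.trans (≡.cong g (≡.sym eₜ)) e

  IsForest : FunDigraph n → Set
  IsForest g = ∀ x → g (walk g n x) ≡ nothing

  module Redirect (f f′ : FunDigraph n) (i a : Fin n) (fi : f i ≡ nothing) (f′i : f′ i ≡ just a)
                  (f′≗f : ∀ x → x ≢ i → f′ x ≡ f x) where

    step-away : ∀ x → x ≢ i → step f′ x ≡ step f x
    step-away x x≢i = ≡.cong (fromMaybe x) (f′≗f x x≢i)

    walk-away : ∀ t x → walk f t x ≢ i → walk f′ t x ≡ walk f t x
    walk-away ℕ.zero    x _ = refl
    walk-away (suc t) x ≢i with walk f t x Fin.≟ i
    ... | yes ≡i = ⊥-elim (≢i (≡.trans (≡.cong (step f) ≡i) (step-root f fi)))
    ... | no  ≢i′ = ≡.trans (≡.cong (step f′) (walk-away t x ≢i′)) (step-away _ ≢i′)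

    walk-hits : ∀ t x → walk f t x ≡ i → Σ ℕ λ s → walk f′ s x ≡ i
    walk-hits ℕ.zero    x e = 0 , e
    walk-hits (suc t) x e with walk f t x Fin.≟ i
    ... | yes ≡i = walk-hits t x ≡i
    ... | no  ≢i = suc t , ≡.trans (≡.cong (step f′) (walk-away t x ≢i)) (≡.trans (step-away _ ≢i) e)

    root-pullback : ∀ t x → f′ (walk f′ t x) ≡ nothing → Σ ℕ λ s → f (walk f s x) ≡ nothing
    root-pullback t x e with x Fin.≟ i
    ... | yes refl = 0 , fi
    root-pullback ℕ.zero    x e | no x≢i = 0 , ≡.trans (≡.sym (f′≗f x x≢i)) e
    root-pullback (suc t) x e | no x≢i =
      let s , eₛ = root-pullback t (step f x)
                     (≡.trans (≡.cong f′ (≡.sym (≡.trans (walk-suc f′ t x) (≡.cong (walk f′ t) (step-away x x≢i))))) e)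
      in suc s , ≡.trans (≡.cong f (walk-suc f s x)) eₛ

    forest-before : IsForest f′ → IsForest f
    forest-before forest′ x = let s , eₛ = root-pullback n x (forest′ x) in walk-root-within f s x eₛ

    -- If a lies in the tree of i, redirecting closes a cycle through i.
    cycle : walk f n a ≡ i → f′ (walk f′ n i) ≢ nothing
    cycle ρa≡i = nonroot _ (walk-in-tree n)
      where
      InTree : Fin n → Set
      InTree y = walk f n y ≡ i

      nonroot : ∀ y → InTree y → f′ y ≢ nothing
      nonroot y y∈ e with y Fin.≟ i
      ... | yes refl with () ← ≡.trans (≡.sym f′i) e
      ... | no y≢i = y≢i (≡.trans (≡.sym (walk-root f n (≡.trans (≡.sym (f′≗f y y≢i)) e))) y∈)

      step-in-tree : ∀ y → InTree y → InTree (step f′ y)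
      step-in-tree y y∈ with y Fin.≟ i
      ... | yes refl = ≡.subst InTree (≡.sym (step-arc f′ f′i)) ρa≡i
      ... | no y≢i = ≡.subst InTree (≡.sym (step-away y y≢i))
                       (≡.trans (≡.sym (walk-suc f n y)) (≡.trans (≡.cong (step f) y∈) (step-root f fi)))

      walk-in-tree : ∀ t → InTree (walk f′ t i)
      walk-in-tree ℕ.zero    = walk-root f n fi
      walk-in-tree (suc t) = step-in-tree _ (walk-in-tree t)

    forest-after : IsForest f → walk f n a ≢ i →
      ∀ x → f′ (walk f′ n x) ≡ nothing × walk f′ n x ≡ (if walk f n x == i then walk f n a else walk f n x)
    forest-after forest ρa≢i x with walk f n x Fin.≟ i
    ... | no ρx≢i =
      ≡.subst (λ z → f′ z ≡ nothing) (≡.sym (walk-away n x ρx≢i)) (≡.trans (f′≗f _ ρx≢i) (forest x)) ,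
      walk-away n x ρx≢i
    ... | yes ρx≡i =
      let s , eₛ = walk-hits n x ρx≡i
          via-a : walk f′ (n ℕ.+ suc s) x ≡ walk f n a
          via-a = ≡.trans (walk-+ f′ n (suc s) x) (≡.trans (≡.cong (λ z → walk f′ n (step f′ z)) eₛ)
                    (≡.trans (≡.cong (walk f′ n) (step-arc f′ f′i)) (walk-away n a ρa≢i)))
          root-a : f′ (walk f′ (n ℕ.+ suc s) x) ≡ nothing
          root-a = ≡.subst (λ z → f′ z ≡ nothing) (≡.sym via-a) (≡.trans (f′≗f _ ρa≢i) (forest a))
          root-n = walk-root-within f′ (n ℕ.+ suc s) x root-a
      in root-n , ≡.trans (walk-root-unique f′ n (n ℕ.+ suc s) x root-n root-a) via-a

-- Functional digraphs as subgraphs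

bools : List Bool
bools = true ∷ false ∷ []

choices : ∀ n → List (Maybe (Fin n))
choices n = nothing ∷ map just (allFin n)

module _ {n : ℕ} where

  row : Maybe (Fin n) → Fin n → Bool
  row o y = maybe′ (_== y) false o

  toSubgraph : FunDigraph n → Subgraph n
  toSubgraph g x = row (g x)

  arcCount : FunDigraph n → ℕ
  arcCount g = sumℕ n (λ x → if is-just (g x) then 1 else 0)

  isForest : FunDigraph n → Bool
  isForest g = allB n (λ x → is-nothing (g (walk g n x)))

  isForest⇒IsForest : ∀ g → isForest g ≡ true → IsForest g
  isForest⇒IsForest g e x with g (walk g n x) in eq | allB-true⁻ n e x
  ... | nothing | _ = refl

  IsForest⇒isForest : ∀ g → IsForest g → isForest g ≡ true
  IsForest⇒isForest g forest = allB-true n (λ x → ≡.cong is-nothing (forest x))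

  non-root⇒¬isForest : ∀ g x → g (walk g n x) ≢ nothing → isForest g ≡ false
  non-root⇒¬isForest g x nonroot with isForest g in eq
  ... | false = refl
  ... | true  = ⊥-elim (nonroot (isForest⇒IsForest g eq x))

  row-count : ∀ o → sumℕ n (λ y → if row o y then 1 else 0) ≡ (if is-just o then 1 else 0)
  row-count nothing  = sumℕ-zero n (λ _ → refl)
  row-count (just a) = ≡.trans (sumℕ-single n a (λ y y≢a → ≡.cong (λ b → if b then 1 else 0) (==-≢ (y≢a ∘ ≡.sym))))
                               (≡.cong (λ b → if b then 1 else 0) (==-refl a))

  row-true : ∀ o y → row o y ≡ true → o ≡ just y
  row-true (just a) y e = ≡.cong just (==⇒≡ e)

  outdeg-toSubgraph : ∀ g x → outdeg (toSubgraph g) x ≡ (if is-just (g x) then 1 else 0)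
  outdeg-toSubgraph g x = row-count (g x)

  numArcs-toSubgraph : ∀ g → numArcs (toSubgraph g) ≡ arcCount g
  numArcs-toSubgraph g = sumℕ-cong n (outdeg-toSubgraph g)

  arc-same-root : ∀ g {x y r} → g x ≡ just y → g r ≡ nothing → (walk g n x ≡ r) ⇔ (walk g n y ≡ r)
  arc-same-root g {x} {y} {r} gx gr = mk⇔ to from
    where
    next : walk g (suc n) x ≡ walk g n y
    next = ≡.trans (walk-suc g n x) (≡.cong (walk g n) (step-arc g gx))
    to : walk g n x ≡ r → walk g n y ≡ r
    to ρx≡r = ≡.trans (≡.sym next) (≡.trans (≡.cong (step g) ρx≡r) (step-root g gr))
    from : walk g n y ≡ r → walk g n x ≡ r
    from ρy≡r = ≡.trans (walk-root-unique g n (suc n) x (walk-root-within {n = n} g (suc n) x root) root) (≡.trans next ρy≡r)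
      where
      root : g (walk g (suc n) x) ≡ nothing
      root = ≡.trans (≡.cong g (≡.trans next ρy≡r)) gr

  reach-same-root : ∀ g t {x y r} → reach (toSubgraph g) t x y ≡ true → g r ≡ nothing →
    (walk g n x ≡ r) ⇔ (walk g n y ≡ r)
  reach-same-root g ℕ.zero e gr with ==⇒≡ e
  ... | refl = ⇔-refl
  reach-same-root g (suc t) {x} {y} e gr with ∨-true (reach (toSubgraph g) t x y) e
  ... | inj₁ e′ = reach-same-root g t e′ gr
  ... | inj₂ e′ with l , el ← anyB-true⁻ n e′
    with ∨-true (toSubgraph g l y) (∧-trueʳ (reach (toSubgraph g) t x l) el)
  ... | inj₁ l→y = ⇔-trans (reach-same-root g t (∧-trueˡ _ el) gr) (arc-same-root g (row-true _ _ l→y) gr)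
  ... | inj₂ y→l = ⇔-trans (reach-same-root g t (∧-trueˡ _ el) gr) (⇔-sym (arc-same-root g (row-true _ _ y→l) gr))

  reach-walk : ∀ g t x → reach (toSubgraph g) t x (walk g t x) ≡ true
  reach-walk g ℕ.zero    x = ==-refl x
  reach-walk g (suc t) x with g (walk g t x) in eq
  ... | nothing = ∨-trueˡ _ (reach-walk g t x)
  ... | just y  = ∨-trueʳ (reach (toSubgraph g) t x y) (anyB-true n (walk g t x)
                    (∧-true (reach-walk g t x) (∨-trueˡ _ (≡.trans (≡.cong (λ o → row o y) eq) (==-refl y)))))

  isRootOf-toSubgraph : ∀ g x r → isRootOf (toSubgraph g) x r ≡ (walk g n x == r) ∧ is-nothing (g r)
  isRootOf-toSubgraph g x r
    rewrite outdeg-toSubgraph g r with g r in gr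
  ... | just _  = ≡.trans (Boolₚ.∧-zeroʳ _) (≡.sym (Boolₚ.∧-zeroʳ _))
  ... | nothing = ≡.trans (Boolₚ.∧-identityʳ _) (≡.trans same (≡.sym (Boolₚ.∧-identityʳ _)))
    where
    same : reach (toSubgraph g) n x r ≡ (walk g n x == r)
    same with walk g n x Fin.≟ r
    ... | yes ρx≡r = ≡.subst (λ z → reach (toSubgraph g) n x z ≡ true) ρx≡r (reach-walk g n x)
    ... | no ρx≢r with reach (toSubgraph g) n x r in e
    ...   | false = refl
    ...   | true  = ⊥-elim (ρx≢r (Equivalence.from (reach-same-root g n e gr) (walk-root g n gr)))

  isInForest-toSubgraph : ∀ g → isInForest (toSubgraph g) ≡ isForest g
  isInForest-toSubgraph g = ≡.cong₂ _∧_
    (allB-true n (λ x → ≡.subst (λ k → (k ℕ.≤ᵇ 1) ≡ true) (≡.sym (outdeg-toSubgraph g x)) (≤ᵇ1 (g x))))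
    (allB-cong n one-root)
    where
    ≤ᵇ1 : ∀ (o : Maybe (Fin n)) → ((if is-just o then 1 else 0) ℕ.≤ᵇ 1) ≡ true
    ≤ᵇ1 nothing  = refl
    ≤ᵇ1 (just _) = refl
    one-root : ∀ x → (sumℕ n (λ r → if isRootOf (toSubgraph g) x r then 1 else 0) ℕ.≡ᵇ 1) ≡ is-nothing (g (walk g n x))
    one-root x = ≡.trans (≡.cong (ℕ._≡ᵇ 1) (≡.trans (sumℕ-cong n count) (sumℕ-single n (walk g n x) others)))
                         at-root
      where
      count : ∀ r → (if isRootOf (toSubgraph g) x r then 1 else 0) ≡ (if (walk g n x == r) ∧ is-nothing (g r) then 1 else 0)
      count r = ≡.cong (λ b → if b then 1 else 0) (isRootOf-toSubgraph g x r)
      others : ∀ r → r ≢ walk g n x → (if (walk g n x == r) ∧ is-nothing (g r) then 1 else 0) ≡ 0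
      others r r≢ρx rewrite ==-≢ (r≢ρx ∘ ≡.sym) = refl
      at-root : ((if (walk g n x == walk g n x) ∧ is-nothing (g (walk g n x)) then 1 else 0) ℕ.≡ᵇ 1)
                ≡ is-nothing (g (walk g n x))
      at-root rewrite ==-refl (walk g n x) with g (walk g n x)
      ... | nothing = refl
      ... | just _  = refl

  isRootOf-forest : ∀ g → isForest g ≡ true → ∀ x r → isRootOf (toSubgraph g) x r ≡ (walk g n x == r)
  isRootOf-forest g forest x r rewrite isRootOf-toSubgraph g x r with walk g n x Fin.≟ r
  ... | yes refl = ≡.cong (true ∧_) (≡.cong is-nothing (isForest⇒IsForest g forest x))
  ... | no _     = refl

  _≗₂_ : Subgraph n → Subgraph n → Set
  S ≗₂ S′ = ∀ x y → S x y ≡ S′ x y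

  outdeg-cong : ∀ {S S′} → S ≗₂ S′ → ∀ x → outdeg S x ≡ outdeg S′ x
  outdeg-cong e x = sumℕ-cong n (λ y → ≡.cong (λ b → if b then 1 else 0) (e x y))

  numArcs-cong : ∀ {S S′} → S ≗₂ S′ → numArcs S ≡ numArcs S′
  numArcs-cong e = sumℕ-cong n (outdeg-cong e)

  reach-cong : ∀ {S S′} → S ≗₂ S′ → ∀ t x y → reach S t x y ≡ reach S′ t x y
  reach-cong e ℕ.zero    x y = refl
  reach-cong e (suc t) x y = ≡.cong₂ _∨_ (reach-cong e t x y)
    (anyB-cong n (λ l → ≡.cong₂ _∧_ (reach-cong e t x l) (≡.cong₂ _∨_ (e l y) (e y l))))

  isRootOf-cong : ∀ {S S′} → S ≗₂ S′ → ∀ x r → isRootOf S x r ≡ isRootOf S′ x r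
  isRootOf-cong e x r = ≡.cong₂ _∧_ (reach-cong e n x r) (≡.cong (ℕ._≡ᵇ 0) (outdeg-cong e r))

  isInForest-cong : ∀ {S S′} → S ≗₂ S′ → isInForest S ≡ isInForest S′
  isInForest-cong e = ≡.cong₂ _∧_ (allB-cong n (λ x → ≡.cong (ℕ._≤ᵇ 1) (outdeg-cong e x)))
    (allB-cong n (λ x → ≡.cong (ℕ._≡ᵇ 1)
      (sumℕ-cong n (λ r → ≡.cong (λ b → if b then 1 else 0) (isRootOf-cong e x r)))))

-- Multinomial coefficients and partitions

prodFact-cong : ∀ K {p q : Vector ℕ K} → (∀ i → p i ≡ q i) → prodFact K p ≡ prodFact K q
prodFact-cong ℕ.zero    e = refl
prodFact-cong (suc K) e = ≡.cong₂ ℕ._*_ (≡.cong ℕ._! (e Fin.zero)) (prodFact-cong K (e ∘ Fin.suc))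

prodFact-remove : ∀ K (p : Vector ℕ (suc K)) t → prodFact (suc K) p ≡ p t ℕ.! ℕ.* prodFact K (p ∘ punchIn t)
prodFact-remove K       p Fin.zero    = refl
prodFact-remove (suc K) p (Fin.suc t) =
  ≡.trans (≡.cong (p Fin.zero ℕ.! ℕ.*_) (prodFact-remove K (p ∘ Fin.suc) t))
          (x*yz≡y*xz (p Fin.zero ℕ.!) (p (Fin.suc t) ℕ.!) (prodFact K (p ∘ Fin.suc ∘ punchIn t)))

prodFact∣sum! : ∀ K (p : Vector ℕ K) → prodFact K p ∣ sumℕ K p ℕ.!
prodFact∣sum! ℕ.zero    p = ∣-refl
prodFact∣sum! (suc K) p = ∣-trans (*-monoʳ-∣ (p Fin.zero ℕ.!) (prodFact∣sum! K (p ∘ Fin.suc)))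
  (≡.subst (λ r → p Fin.zero ℕ.! ℕ.* r ℕ.! ∣ (p Fin.zero ℕ.+ rest) ℕ.!) (ℕₚ.m+n∸m≡n (p Fin.zero) rest)
           (k![n∸k]!∣n! (ℕₚ.m≤m+n (p Fin.zero) rest)))
  where rest = sumℕ K (p ∘ Fin.suc)

multinomial*prodFact : ∀ K (p : Vector ℕ K) → multinomial K p ℕ.* prodFact K p ≡ sumℕ K p ℕ.!
multinomial*prodFact K p = m/n*n≡m {{prodFact-nz K p}} (prodFact∣sum! K p)

module _ {K} (p : Vector ℕ (suc K)) (t : Fin (suc K)) {v} (p-t : p t ≡ suc v) where

  private
    p⁻ : Vector ℕ (suc K)
    p⁻ = Vec.updateAt p t ℕ.pred

    p⁻-t : p⁻ t ≡ v
    p⁻-t = ≡.trans (Vecₚ.updateAt-updates t p) (≡.cong ℕ.pred p-t)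

    p⁻-other : ∀ c → p⁻ (punchIn t c) ≡ p (punchIn t c)
    p⁻-other c = Vecₚ.updateAt-minimal (punchIn t c) t p (Finₚ.punchInᵢ≢i t c)

  sumℕ-updateAt-pred : sumℕ (suc K) p ≡ suc (sumℕ (suc K) p⁻)
  sumℕ-updateAt-pred = begin
    sumℕ (suc K) p                          ≡⟨ sumℕ-remove K p t ⟩
    p t ℕ.+ sumℕ K (p ∘ punchIn t)          ≡⟨ ≡.cong₂ ℕ._+_ p-t (sumℕ-cong K (≡.sym ∘ p⁻-other)) ⟩
    suc v ℕ.+ sumℕ K (p⁻ ∘ punchIn t)       ≡⟨ ≡.cong (λ x → suc x ℕ.+ sumℕ K (p⁻ ∘ punchIn t)) p⁻-t ⟨
    suc (p⁻ t ℕ.+ sumℕ K (p⁻ ∘ punchIn t))  ≡⟨ ≡.cong suc (sumℕ-remove K p⁻ t) ⟨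
    suc (sumℕ (suc K) p⁻)                   ∎
    where open ≡.≡-Reasoning

  prodFact-updateAt-pred : prodFact (suc K) p ≡ suc v ℕ.* prodFact (suc K) p⁻
  prodFact-updateAt-pred = begin
    prodFact (suc K) p
      ≡⟨ prodFact-remove K p t ⟩
    p t ℕ.! ℕ.* prodFact K (p ∘ punchIn t)
      ≡⟨ ≡.cong₂ (λ x y → x ℕ.! ℕ.* y) p-t (prodFact-cong K (≡.sym ∘ p⁻-other)) ⟩
    suc v ℕ.! ℕ.* prodFact K (p⁻ ∘ punchIn t)
      ≡⟨ ℕₚ.*-assoc (suc v) (v ℕ.!) _ ⟩
    suc v ℕ.* (v ℕ.! ℕ.* prodFact K (p⁻ ∘ punchIn t))
      ≡⟨ ≡.cong (λ x → suc v ℕ.* (x ℕ.! ℕ.* prodFact K (p⁻ ∘ punchIn t))) p⁻-t ⟨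
    suc v ℕ.* (p⁻ t ℕ.! ℕ.* prodFact K (p⁻ ∘ punchIn t))
      ≡⟨ ≡.cong (suc v ℕ.*_) (prodFact-remove K p⁻ t) ⟨
    suc v ℕ.* prodFact (suc K) p⁻
      ∎
    where open ≡.≡-Reasoning

sumℕ-*ʳ : ∀ K (f : Vector ℕ K) c → sumℕ K f ℕ.* c ≡ sumℕ K (λ t → f t ℕ.* c)
sumℕ-*ʳ ℕ.zero    f c = refl
sumℕ-*ʳ (suc K) f c =
  ≡.trans (ℕₚ.*-distribʳ-+ c (f Fin.zero) _) (≡.cong (f Fin.zero ℕ.* c ℕ.+_) (sumℕ-*ʳ K (f ∘ Fin.suc) c))

-- Pascal's rule: classify the arrangements of a multiset by their first element.
multinomial-pascal : ∀ K (p : Vector ℕ K) s → sumℕ K p ≡ suc s →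
  multinomial K p ≡ sumℕ K (λ t → if p t ℕ.≡ᵇ 0 then 0 else multinomial K (Vec.updateAt p t ℕ.pred))
multinomial-pascal (suc K) p s Σp≡1+s = ≡.sym (ℕₚ.*-cancelʳ-≡ _ _ (prodFact (suc K) p) {{prodFact-nz (suc K) p}} (begin
  sumℕ (suc K) M⁻ ℕ.* prodFact (suc K) p            ≡⟨ sumℕ-*ʳ (suc K) M⁻ (prodFact (suc K) p) ⟩
  sumℕ (suc K) (λ t → M⁻ t ℕ.* prodFact (suc K) p)  ≡⟨ sumℕ-cong (suc K) (λ t → term t (p t) refl) ⟩
  sumℕ (suc K) (λ t → p t ℕ.* s ℕ.!)                ≡⟨ sumℕ-*ʳ (suc K) p (s ℕ.!) ⟨
  sumℕ (suc K) p ℕ.* s ℕ.!                          ≡⟨ ≡.cong (ℕ._* s ℕ.!) Σp≡1+s ⟩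
  suc s ℕ.!                                         ≡⟨ ≡.cong ℕ._! Σp≡1+s ⟨
  sumℕ (suc K) p ℕ.!                                ≡⟨ multinomial*prodFact (suc K) p ⟨
  multinomial (suc K) p ℕ.* prodFact (suc K) p      ∎))
  where
  open ≡.≡-Reasoning
  M⁻ : Vector ℕ (suc K)
  M⁻ t = if p t ℕ.≡ᵇ 0 then 0 else multinomial (suc K) (Vec.updateAt p t ℕ.pred)
  term : ∀ t x → p t ≡ x → M⁻ t ℕ.* prodFact (suc K) p ≡ p t ℕ.* s ℕ.!
  term t ℕ.zero    p-t rewrite p-t = refl
  term t (suc v) p-t rewrite p-t = begin
    multinomial (suc K) p⁻ ℕ.* prodFact (suc K) p
      ≡⟨ ≡.cong (multinomial (suc K) p⁻ ℕ.*_) (prodFact-updateAt-pred p t p-t) ⟩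
    multinomial (suc K) p⁻ ℕ.* (suc v ℕ.* prodFact (suc K) p⁻)
      ≡⟨ x*yz≡y*xz (multinomial (suc K) p⁻) (suc v) _ ⟩
    suc v ℕ.* (multinomial (suc K) p⁻ ℕ.* prodFact (suc K) p⁻)
      ≡⟨ ≡.cong (suc v ℕ.*_) (multinomial*prodFact (suc K) p⁻) ⟩
    suc v ℕ.* sumℕ (suc K) p⁻ ℕ.!
      ≡⟨ ≡.cong (λ x → suc v ℕ.* x ℕ.!) Σp⁻≡s ⟩
    suc v ℕ.* s ℕ.!
      ∎
    where
    p⁻ = Vec.updateAt p t ℕ.pred
    Σp⁻≡s : sumℕ (suc K) p⁻ ≡ s
    Σp⁻≡s = ℕₚ.suc-injective (≡.trans (≡.sym (sumℕ-updateAt-pred p t p-t)) Σp≡1+s)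

div-cong : ∀ {a a′ b b′} .{{_ : NonZero b}} .{{_ : NonZero b′}} → a ≡ a′ → b ≡ b′ → a ℕ./ b ≡ a′ ℕ./ b′
div-cong refl refl = refl

multinomial-cong : ∀ K {p q : Vector ℕ K} → (∀ i → p i ≡ q i) → multinomial K p ≡ multinomial K q
multinomial-cong K {p} {q} e =
  div-cong {{prodFact-nz K p}} {{prodFact-nz K q}} (≡.cong ℕ._! (sumℕ-cong K e)) (prodFact-cong K e)

-- p i is the multiplicity of the part i + 1 (the paper's p_{i+1}), so partitionSize K p is Σ i·p_i.
partitionSize : ∀ K → Vector ℕ K → ℕ
partitionSize K p = sumℕ K (λ i → suc (toℕ i) ℕ.* p i)

partitionSize-cong : ∀ K {p q : Vector ℕ K} → (∀ i → p i ≡ q i) → partitionSize K p ≡ partitionSize K q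
partitionSize-cong K e = sumℕ-cong K (λ i → ≡.cong (suc (toℕ i) ℕ.*_) (e i))

part≤partitionSize : ∀ K (p : Vector ℕ K) i → suc (toℕ i) ℕ.* p i ≤ partitionSize K p
part≤partitionSize K p = term≤sumℕ K (λ i → suc (toℕ i) ℕ.* p i)

pad : ∀ k {d} → Vector ℕ k → Vector ℕ (k ℕ.+ d)
pad ℕ.zero    q = λ _ → 0
pad (suc k) q = q Fin.zero ∷ᵥ pad k (q ∘ Fin.suc)

sumℕ-pad : ∀ k d (H : ℕ → ℕ → ℕ) (q : Vector ℕ k) → (∀ c → H c 0 ≡ 0) →
  sumℕ (k ℕ.+ d) (λ c → H (toℕ c) (pad k q c)) ≡ sumℕ k (λ c → H (toℕ c) (q c))
sumℕ-pad ℕ.zero    d H q H0 = sumℕ-zero d (λ c → H0 (toℕ c))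
sumℕ-pad (suc k) d H q H0 = ≡.cong (H 0 (q Fin.zero) ℕ.+_) (sumℕ-pad k d (H ∘ suc) (q ∘ Fin.suc) (H0 ∘ suc))

prodFact-pad : ∀ k d (q : Vector ℕ k) → prodFact (k ℕ.+ d) (pad k q) ≡ prodFact k q
prodFact-pad ℕ.zero    ℕ.zero    q = refl
prodFact-pad ℕ.zero    (suc d) q = ≡.trans (ℕₚ.+-identityʳ _) (prodFact-pad 0 d q)
prodFact-pad (suc k) d q = ≡.cong (q Fin.zero ℕ.! ℕ.*_) (prodFact-pad k d (q ∘ Fin.suc))

multinomial-pad : ∀ k d (q : Vector ℕ k) → multinomial (k ℕ.+ d) (pad k q) ≡ multinomial k q
multinomial-pad k d q = div-cong {{prodFact-nz (k ℕ.+ d) (pad k q)}} {{prodFact-nz k q}}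
  (≡.cong ℕ._! (sumℕ-pad k d (λ _ x → x) q (λ _ → refl))) (prodFact-pad k d q)

partitionSize-pad : ∀ k d (q : Vector ℕ k) → partitionSize (k ℕ.+ d) (pad k q) ≡ partitionSize k q
partitionSize-pad k d q = sumℕ-pad k d (λ c x → suc c ℕ.* x) q (λ c → ℕₚ.*-zeroʳ (suc c))

partitionSize-insert-suc : ∀ m (t : Fin (suc m)) v (p′ : Vector ℕ m) →
  partitionSize (suc m) (insert t (suc v) p′) ≡ partitionSize (suc m) (insert t v p′) ℕ.+ suc (toℕ t)
partitionSize-insert-suc m t v p′ = begin
  partitionSize (suc m) (insert t (suc v) p′)  ≡⟨ sumℕ-insert m size t (suc v) p′ ⟩
  suc (toℕ t) ℕ.* suc v ℕ.+ rest               ≡⟨ ≡.cong (ℕ._+ rest) (ℕₚ.*-suc (suc (toℕ t)) v) ⟩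
  suc (toℕ t) ℕ.+ suc (toℕ t) ℕ.* v ℕ.+ rest   ≡⟨ xy+z≡yz+x (suc (toℕ t)) _ rest ⟩
  suc (toℕ t) ℕ.* v ℕ.+ rest ℕ.+ suc (toℕ t)   ≡⟨ ≡.cong (ℕ._+ suc (toℕ t)) (sumℕ-insert m size t v p′) ⟨
  partitionSize (suc m) (insert t v p′) ℕ.+ suc (toℕ t) ∎
  where
  open ≡.≡-Reasoning
  size : Fin (suc m) → ℕ → ℕ
  size c x = suc (toℕ c) ℕ.* x
  rest = sumℕ m (λ c → suc (toℕ (punchIn t c)) ℕ.* p′ c)

-- Finite sums in a commutative ring

module _ {c ℓ} (R : CommutativeRing c ℓ) where

  open CommutativeRing R hiding (zero) renaming (refl to ≈-refl)
  open import Algebra.Properties.Semiring.Sum semiring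
  open import Algebra.Properties.Ring ring using (-‿distribˡ-*; -1*x≈-x)
  open import Algebra.Properties.Group +-group using (∙-cancelʳ; x≈z//y)
  open import Algebra.Properties.CommutativeSemigroup *-commutativeSemigroup using ()
    renaming (x∙yz≈y∙xz to x*yz≈y*xz; x∙yz≈xz∙y to x*yz≈xz*y)
  open import Algebra.Solver.Ring.NaturalCoefficients.Default commutativeSemiring using (solve; _:=_; _:*_)
  open import Algebra.Properties.CommutativeSemigroup +-commutativeSemigroup using (interchange; x∙yz≈y∙xz)
  open import Relation.Binary.Reasoning.Setoid setoid

  sumR≡∑ : ∀ m (f : Fin m → Carrier) → sumR R m f ≡ ∑[ i < m ] f i
  sumR≡∑ ℕ.zero    f = refl
  sumR≡∑ (suc m) f = ≡.cong (f Fin.zero +_) (sumR≡∑ m (f ∘ Fin.suc))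

  if-cong : ∀ {b b′ x x′} → b ≡ b′ → x ≈ x′ → (if b then x else 0#) ≈ (if b′ then x′ else 0#)
  if-cong {true}  refl x≈x′ = x≈x′
  if-cong {false} refl x≈x′ = ≈-refl

  𝟙 : Bool → Carrier
  𝟙 b = if b then 1# else 0#

  𝟙-if : ∀ b x → (if b then x else 0#) ≈ 𝟙 b * x
  𝟙-if true  x = sym (*-identityˡ x)
  𝟙-if false x = sym (zeroˡ x)

  ∑-zero : ∀ m {f : Fin m → Carrier} → (∀ i → f i ≈ 0#) → ∑[ i < m ] f i ≈ 0#
  ∑-zero m e = trans (sum-cong-≋ e) (sum-replicate-zero m)

  ∑-single : ∀ m (f : Fin m → Carrier) i → (∀ j → j ≢ i → f j ≈ 0#) → ∑[ j < m ] f j ≈ f i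
  ∑-single (suc m) f i h = begin
    sum f                          ≈⟨ sum-remove f ⟩
    f i + sum (Vec.removeAt f i)   ≈⟨ +-congˡ (∑-zero m (λ j → h (punchIn i j) (Finₚ.punchInᵢ≢i i j))) ⟩
    f i + 0#                       ≈⟨ +-identityʳ (f i) ⟩
    f i                            ∎

  ∑-toℕ-last : ∀ m (F : ℕ → Carrier) → ∑[ k < suc m ] F (toℕ k) ≈ ∑[ k < m ] F (toℕ k) + F m
  ∑-toℕ-last m F = trans (sum-init-last (F ∘ toℕ))
    (+-cong (sum-cong-≋ {m} (λ k → reflexive (≡.cong F (Finₚ.toℕ-inject₁ k))))
            (reflexive (≡.cong F (Finₚ.toℕ-fromℕ m))))

  sumMap : (A → Carrier) → List A → Carrier
  sumMap f xs = sumList R (map f xs)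

  sumMap-cong : ∀ (xs : List A) {f g : A → Carrier} → (∀ x → f x ≈ g x) → sumMap f xs ≈ sumMap g xs
  sumMap-cong []       e = ≈-refl
  sumMap-cong (x ∷ xs) e = +-cong (e x) (sumMap-cong xs e)

  sumMap-zero : ∀ (xs : List A) {f : A → Carrier} → (∀ x → f x ≈ 0#) → sumMap f xs ≈ 0#
  sumMap-zero []       e = ≈-refl
  sumMap-zero (x ∷ xs) e = trans (+-cong (e x) (sumMap-zero xs e)) (+-identityˡ 0#)

  sumMap-+ : ∀ (xs : List A) (f g : A → Carrier) → sumMap (λ x → f x + g x) xs ≈ sumMap f xs + sumMap g xs
  sumMap-+ []       f g = sym (+-identityˡ 0#)
  sumMap-+ (x ∷ xs) f g = trans (+-congˡ (sumMap-+ xs f g)) (interchange _ _ _ _)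

  *-distribˡ-sumMap : ∀ (xs : List A) y (f : A → Carrier) → y * sumMap f xs ≈ sumMap (λ x → y * f x) xs
  *-distribˡ-sumMap []       y f = zeroʳ y
  *-distribˡ-sumMap (x ∷ xs) y f = trans (distribˡ y _ _) (+-congˡ (*-distribˡ-sumMap xs y f))

  sumMap-++ : ∀ (xs ys : List A) (f : A → Carrier) → sumMap f (xs ++ ys) ≈ sumMap f xs + sumMap f ys
  sumMap-++ []       ys f = sym (+-identityˡ _)
  sumMap-++ (x ∷ xs) ys f = trans (+-congˡ (sumMap-++ xs ys f)) (sym (+-assoc _ _ _))

  sumMap-filterᵇ : ∀ (p : A → Bool) (xs : List A) (f : A → Carrier) →
    sumMap f (filterᵇ p xs) ≈ sumMap (λ x → if p x then f x else 0#) xs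
  sumMap-filterᵇ p []       f = ≈-refl
  sumMap-filterᵇ p (x ∷ xs) f with p x
  ... | true  = +-congˡ (sumMap-filterᵇ p xs f)
  ... | false = trans (sumMap-filterᵇ p xs f) (sym (+-identityˡ _))

  sumMap-∑-comm : ∀ (xs : List A) m (f : A → Fin m → Carrier) →
    sumMap (λ x → ∑[ i < m ] f x i) xs ≈ ∑[ i < m ] sumMap (λ x → f x i) xs
  sumMap-∑-comm []       m f = sym (∑-zero m (λ _ → ≈-refl))
  sumMap-∑-comm (x ∷ xs) m f = trans (+-congˡ (sumMap-∑-comm xs m f)) (sym (∑-distrib-+ (f x) _))

  sumMap-map : ∀ (xs : List A) (g : A → B) (f : B → Carrier) → sumMap f (map g xs) ≈ sumMap (f ∘ g) xs
  sumMap-map []       g f = ≈-refl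
  sumMap-map (x ∷ xs) g f = +-congˡ (sumMap-map xs g f)

  sumMap-concatMap : ∀ (xs : List A) (g : A → List B) (f : B → Carrier) →
    sumMap f (concatMap g xs) ≈ sumMap (λ x → sumMap f (g x)) xs
  sumMap-concatMap []       g f = ≈-refl
  sumMap-concatMap (x ∷ xs) g f = trans (sumMap-++ (g x) _ f) (+-congˡ (sumMap-concatMap xs g f))

  sumMap-comm : ∀ (xs : List A) (ys : List B) (f : A → B → Carrier) →
    sumMap (λ x → sumMap (f x) ys) xs ≈ sumMap (λ y → sumMap (λ x → f x y) xs) ys
  sumMap-comm []       ys f = sym (sumMap-zero ys (λ _ → ≈-refl))
  sumMap-comm (x ∷ xs) ys f = trans (+-congˡ (sumMap-comm xs ys f)) (sym (sumMap-+ ys (f x) _))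

  sumMap-tabulate : ∀ m (g : Fin m → A) (f : A → Carrier) → sumMap f (tabulate g) ≈ ∑[ i < m ] f (g i)
  sumMap-tabulate ℕ.zero    g f = ≈-refl
  sumMap-tabulate (suc m) g f = +-congˡ (sumMap-tabulate m (g ∘ Fin.suc) f)

  sumFun : List A → (m : ℕ) → (Vector A m → Carrier) → Carrier
  sumFun xs ℕ.zero    ψ = ψ []ᵥ
  sumFun xs (suc m) ψ = sumMap (λ x → sumFun xs m (λ f → ψ (x ∷ᵥ f))) xs

  RespectsPointwise : ∀ {m} → (Vector A m → Carrier) → Set _
  RespectsPointwise ψ = ∀ {f g} → (∀ i → f i ≡ g i) → ψ f ≈ ψ g

  module _ (xs : List A) where

    sumFun-cong : ∀ m {ψ φ : Vector A m → Carrier} → (∀ f → ψ f ≈ φ f) → sumFun xs m ψ ≈ sumFun xs m φ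
    sumFun-cong ℕ.zero    e = e []ᵥ
    sumFun-cong (suc m) e = sumMap-cong xs (λ x → sumFun-cong m (λ f → e (x ∷ᵥ f)))

    sumFun-zero : ∀ m {ψ : Vector A m → Carrier} → (∀ f → ψ f ≈ 0#) → sumFun xs m ψ ≈ 0#
    sumFun-zero ℕ.zero    e = e []ᵥ
    sumFun-zero (suc m) e = sumMap-zero xs (λ x → sumFun-zero m (λ f → e (x ∷ᵥ f)))

    sumFun-+ : ∀ m (ψ φ : Vector A m → Carrier) →
      sumFun xs m (λ f → ψ f + φ f) ≈ sumFun xs m ψ + sumFun xs m φ
    sumFun-+ ℕ.zero    ψ φ = ≈-refl
    sumFun-+ (suc m) ψ φ = trans (sumMap-cong xs (λ x → sumFun-+ m (ψ ∘ (x ∷ᵥ_)) (φ ∘ (x ∷ᵥ_)))) (sumMap-+ xs _ _)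

    *-distribˡ-sumFun : ∀ m y (ψ : Vector A m → Carrier) → y * sumFun xs m ψ ≈ sumFun xs m (λ f → y * ψ f)
    *-distribˡ-sumFun ℕ.zero    y ψ = ≈-refl
    *-distribˡ-sumFun (suc m) y ψ =
      trans (*-distribˡ-sumMap xs y _) (sumMap-cong xs (λ x → *-distribˡ-sumFun m y (ψ ∘ (x ∷ᵥ_))))

    sumFun-∑-comm : ∀ m k (ψ : Vector A m → Fin k → Carrier) →
      sumFun xs m (λ f → ∑[ i < k ] ψ f i) ≈ ∑[ i < k ] sumFun xs m (λ f → ψ f i)
    sumFun-∑-comm ℕ.zero    k ψ = ≈-refl
    sumFun-∑-comm (suc m) k ψ =
      trans (sumMap-cong xs (λ x → sumFun-∑-comm m k (ψ ∘ (x ∷ᵥ_)))) (sumMap-∑-comm xs k _)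

    sumMap-sumFun-comm : ∀ m (ys : List B) (ψ : B → Vector A m → Carrier) →
      sumMap (λ y → sumFun xs m (ψ y)) ys ≈ sumFun xs m (λ f → sumMap (λ y → ψ y f) ys)
    sumMap-sumFun-comm ℕ.zero    ys ψ = ≈-refl
    sumMap-sumFun-comm (suc m) ys ψ = trans (sumMap-comm ys xs _)
      (sumMap-cong xs (λ x → sumMap-sumFun-comm m ys (λ y f → ψ y (x ∷ᵥ f))))

    sumFun-insert : ∀ m i (ψ : Vector A (suc m) → Carrier) →
      sumFun xs (suc m) ψ ≈ sumMap (λ x → sumFun xs m (λ f → ψ (insert i x f))) xs
    sumFun-insert m       Fin.zero    ψ = ≈-refl
    sumFun-insert (suc m) (Fin.suc i) ψ = trans
      (sumMap-cong xs (λ y → sumFun-insert m i (ψ ∘ (y ∷ᵥ_))))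
      (sumMap-comm xs xs _)

    -- The first hypothesis says that x₀ occurs exactly once in xs.
    sumFun-const : ∀ (x₀ : A) →
      (∀ (h : A → Carrier) → (∀ x → x ≢ x₀ → h x ≈ 0#) → sumMap h xs ≈ h x₀) →
      ∀ m {ψ : Vector A m → Carrier} {v} → (∀ f i → f i ≢ x₀ → ψ f ≈ 0#) →
      (∀ f → (∀ i → f i ≡ x₀) → ψ f ≈ v) → sumFun xs m ψ ≈ v
    sumFun-const x₀ once ℕ.zero    vanish value = value []ᵥ λ ()
    sumFun-const x₀ once (suc m) vanish value = trans
      (once _ (λ x x≢x₀ → sumFun-zero m (λ f → vanish (x ∷ᵥ f) Fin.zero x≢x₀)))
      (sumFun-const x₀ once m (λ f i → vanish (x₀ ∷ᵥ f) (Fin.suc i))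
        (λ f f≡x₀ → value (x₀ ∷ᵥ f) λ { Fin.zero → refl ; (Fin.suc i) → f≡x₀ i }))

  sumMap-allFuns : ∀ (xs : List A) m {ψ : Vector A m → Carrier} → RespectsPointwise ψ →
    sumMap ψ (allFuns xs m) ≈ sumFun xs m ψ
  sumMap-allFuns xs ℕ.zero    resp = trans (+-identityʳ _) (resp λ ())
  sumMap-allFuns xs (suc m) {ψ} resp =
    trans (sumMap-concatMap xs _ ψ) (sumMap-cong xs (λ x →
      trans (sumMap-map (allFuns xs m) _ ψ)
      (trans (sumMap-allFuns xs m (λ e → resp λ { Fin.zero → refl ; (Fin.suc i) → e i }))
             (sumFun-cong xs m (λ f → resp λ { Fin.zero → refl ; (Fin.suc i) → refl })))))

  sumMap-upTo-last : ∀ (h : ℕ → Carrier) B → sumMap h (upTo (suc B)) ≈ sumMap h (upTo B) + h B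
  sumMap-upTo-last h B = trans (reflexive (≡.cong (sumMap h) (≡.sym (Listₚ.upTo-∷ʳ B))))
                              (trans (sumMap-++ (upTo B) (B ∷ []) h) (+-congˡ (+-identityʳ (h B))))

  sumMap-upTo-first : ∀ (h : ℕ → Carrier) B → sumMap h (upTo (suc B)) ≈ h 0 + sumMap (h ∘ suc) (upTo B)
  sumMap-upTo-first h B = +-congˡ (trans (reflexive (≡.cong (sumMap h) (≡.sym (Listₚ.map-applyUpTo (λ v → v) suc B))))
                                         (sumMap-map (upTo B) suc h))

  sumFun-upTo-suc : ∀ B K (ψ : Vector ℕ K → Carrier) → (∀ p c → p c ≡ B → ψ p ≈ 0#) →
    sumFun (upTo (suc B)) K ψ ≈ sumFun (upTo B) K ψ
  sumFun-upTo-suc B ℕ.zero    ψ vanish = ≈-refl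
  sumFun-upTo-suc B (suc K) ψ vanish = begin
    sumMap (λ v → sumFun (upTo (suc B)) K (ψ ∘ (v ∷ᵥ_))) (upTo (suc B))
      ≈⟨ sumMap-cong (upTo (suc B)) (λ v → sumFun-upTo-suc B K (ψ ∘ (v ∷ᵥ_)) (λ p c → vanish (v ∷ᵥ p) (Fin.suc c))) ⟩
    sumMap (λ v → sumFun (upTo B) K (ψ ∘ (v ∷ᵥ_))) (upTo (suc B))
      ≈⟨ sumMap-upTo-last _ B ⟩
    sumMap (λ v → sumFun (upTo B) K (ψ ∘ (v ∷ᵥ_))) (upTo B) + sumFun (upTo B) K (ψ ∘ (B ∷ᵥ_))
      ≈⟨ +-congˡ (sumFun-zero (upTo B) K (λ p → vanish (B ∷ᵥ p) Fin.zero refl)) ⟩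
    sumMap (λ v → sumFun (upTo B) K (ψ ∘ (v ∷ᵥ_))) (upTo B) + 0#
      ≈⟨ +-identityʳ _ ⟩
    sumFun (upTo B) (suc K) ψ ∎

  sumFun-upTo-+ : ∀ d B K (ψ : Vector ℕ K → Carrier) → (∀ p c → B ≤ p c → ψ p ≈ 0#) →
    sumFun (upTo (d ℕ.+ B)) K ψ ≈ sumFun (upTo B) K ψ
  sumFun-upTo-+ ℕ.zero    B K ψ vanish = ≈-refl
  sumFun-upTo-+ (suc d) B K ψ vanish = trans
    (sumFun-upTo-suc (d ℕ.+ B) K ψ (λ p c e → vanish p c (ℕₚ.≤-trans (ℕₚ.m≤n+m B d) (ℕₚ.≤-reflexive (≡.sym e)))))
    (sumFun-upTo-+ d B K ψ vanish)

  sumFun-pad : ∀ B k d (ψ : Vector ℕ (k ℕ.+ d) → Carrier) → RespectsPointwise ψ →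
    (∀ p c → p (k Fin.↑ʳ c) ≢ 0 → ψ p ≈ 0#) →
    sumFun (upTo (suc B)) (k ℕ.+ d) ψ ≈ sumFun (upTo (suc B)) k (ψ ∘ pad k)
  sumFun-pad B ℕ.zero    d ψ resp vanish = sumFun-const (upTo (suc B)) 0 once d vanish (λ p p≡0 → resp p≡0)
    where
    once : ∀ (h : ℕ → Carrier) → (∀ v → v ≢ 0 → h v ≈ 0#) → sumMap h (upTo (suc B)) ≈ h 0
    once h h≈0 = trans (sumMap-upTo-first h B)
                       (trans (+-congˡ (sumMap-zero (upTo B) (λ v → h≈0 (suc v) λ ()))) (+-identityʳ _))
  sumFun-pad B (suc k) d ψ resp vanish = sumMap-cong (upTo (suc B)) (λ v →
    sumFun-pad B k d (ψ ∘ (v ∷ᵥ_)) (λ e → resp λ { Fin.zero → refl ; (Fin.suc c) → e c }) (λ p c → vanish (v ∷ᵥ p) c))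

  ∑-neg : ∀ m (f : Fin m → Carrier) → ∑[ i < m ] (- f i) ≈ - ∑[ i < m ] f i
  ∑-neg m f = begin
    ∑[ i < m ] (- f i)           ≈⟨ sum-cong-≋ {m} (λ i → -1*x≈-x (f i)) ⟨
    ∑[ i < m ] (- 1# * f i)      ≈⟨ *-distribˡ-sum {m} (- 1#) f ⟨
    - 1# * ∑[ i < m ] f i        ≈⟨ -1*x≈-x _ ⟩
    - ∑[ i < m ] f i             ∎

  ∑-reverse : ∀ m (F : ℕ → Carrier) → ∑[ k < suc m ] F (toℕ k) ≈ ∑[ k < suc m ] F (m ∸ toℕ k)
  ∑-reverse m F = trans (∑-permute (F ∘ toℕ) reverse)
    (sum-cong-≋ {suc m} (λ k → reflexive (≡.cong F (Finₚ.opposite-prop k))))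
    where
    reverse : Permutation′ (suc m)
    reverse = permutation Fin.opposite Fin.opposite Finₚ.opposite-involutive Finₚ.opposite-involutive

  sumMap-choices : ∀ n (h : Maybe (Fin n) → Carrier) → sumMap h (choices n) ≈ h nothing + ∑[ a < n ] h (just a)
  sumMap-choices n h = +-congˡ (trans (sumMap-map (allFin n) just h) (sumMap-tabulate n (λ a → a) (h ∘ just)))

  open import Algebra.Properties.CommutativeMonoid.Sum *-commutativeMonoid using ()
    renaming (sum to ∏; sum-cong-≋ to ∏-cong; sum-remove to ∏-remove; sum-replicate-zero to ∏-replicate-one)

  prodR≡∏ : ∀ m (f : Fin m → Carrier) → prodR R m f ≡ ∏ f
  prodR≡∏ ℕ.zero    f = refl
  prodR≡∏ (suc m) f = ≡.cong (f Fin.zero *_) (prodR≡∏ m (f ∘ Fin.suc))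

  prodR-cong : ∀ m {f g : Fin m → Carrier} → (∀ i → f i ≈ g i) → prodR R m f ≈ prodR R m g
  prodR-cong m {f} {g} e = begin
    prodR R m f  ≡⟨ prodR≡∏ m f ⟩
    ∏ f          ≈⟨ ∏-cong e ⟩
    ∏ g          ≡⟨ prodR≡∏ m g ⟨
    prodR R m g  ∎

  prodR-remove : ∀ m (f : Fin (suc m) → Carrier) i → prodR R (suc m) f ≈ f i * prodR R m (f ∘ punchIn i)
  prodR-remove m f i = begin
    prodR R (suc m) f                 ≡⟨ prodR≡∏ (suc m) f ⟩
    ∏ f                               ≈⟨ ∏-remove {i = i} f ⟩
    f i * ∏ (f ∘ punchIn i)           ≡⟨ ≡.cong (f i *_) (prodR≡∏ m (f ∘ punchIn i)) ⟨
    f i * prodR R m (f ∘ punchIn i)   ∎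

  prodR-one : ∀ m {f : Fin m → Carrier} → (∀ i → f i ≈ 1#) → prodR R m f ≈ 1#
  prodR-one m {f} e = trans (reflexive (prodR≡∏ m f)) (trans (∏-cong e) (∏-replicate-one m))

  prodR-single : ∀ m (f : Fin m → Carrier) i → (∀ j → j ≢ i → f j ≈ 1#) → prodR R m f ≈ f i
  prodR-single (suc m) f i h = trans (prodR-remove m f i)
    (trans (*-congˡ (prodR-one m (λ j → h (punchIn i j) (Finₚ.punchInᵢ≢i i j)))) (*-identityʳ (f i)))

  prodR-zero : ∀ m (f : Fin m → Carrier) i → f i ≈ 0# → prodR R m f ≈ 0#
  prodR-zero (suc m) f i fi≈0 = trans (prodR-remove m f i) (trans (*-congʳ fi≈0) (zeroˡ _))

  -- Sums over subgraphs as sums over functional digraphs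

  -- A row with at most one true entry is row o for exactly one o.
  sumMap-rows : ∀ n (φ : (Fin n → Bool) → Carrier) → RespectsPointwise φ →
    (∀ r → 2 ≤ sumℕ n (λ y → if r y then 1 else 0) → φ r ≈ 0#) →
    sumMap φ (allFuns bools n) ≈ sumMap (φ ∘ row) (choices n)
  sumMap-rows n φ resp vanish = trans (sumMap-allFuns _ n resp) (go n φ resp vanish)
    where
    go : ∀ n (φ : (Fin n → Bool) → Carrier) → RespectsPointwise φ →
      (∀ r → 2 ≤ sumℕ n (λ y → if r y then 1 else 0) → φ r ≈ 0#) →
      sumFun bools n φ ≈ sumMap (φ ∘ row) (choices n)
    go ℕ.zero    φ resp vanish = sym (trans (+-identityʳ _) (resp λ ()))
    go (suc n) φ resp vanish = begin
      sumFun bools n (φ ∘ (true ∷ᵥ_)) + (sumFun bools n (φ ∘ (false ∷ᵥ_)) + 0#)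
        ≈⟨ +-cong only-first (+-identityʳ _) ⟩
      φ (row (just Fin.zero)) + sumFun bools n (φ ∘ (false ∷ᵥ_))
        ≈⟨ +-congˡ (go n (φ ∘ (false ∷ᵥ_)) (λ e → resp λ { Fin.zero → refl ; (Fin.suc y) → e y })
                          (λ r r≥2 → vanish (false ∷ᵥ r) r≥2)) ⟩
      φ (row (just Fin.zero)) + sumMap (λ o → φ (false ∷ᵥ row o)) (choices n)
        ≈⟨ +-congˡ (trans (sumMap-choices n _) (+-cong (resp shift-nothing) (sum-cong-≋ (λ a → resp (shift-just a))))) ⟩
      φ (row (just Fin.zero)) + (φ (row nothing) + ∑[ a < n ] φ (row (just (Fin.suc a))))
        ≈⟨ x∙yz≈y∙xz _ _ _ ⟩
      φ (row nothing) + ∑[ a < suc n ] φ (row (just a))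
        ≈⟨ sumMap-choices (suc n) (φ ∘ row) ⟨
      sumMap (φ ∘ row) (choices (suc n)) ∎
      where
      once : ∀ (h : Bool → Carrier) → (∀ b → b ≢ false → h b ≈ 0#) → sumMap h bools ≈ h false
      once h h≈0 = trans (+-cong (h≈0 true λ ()) (+-identityʳ _)) (+-identityˡ _)
      only-first : sumFun bools n (φ ∘ (true ∷ᵥ_)) ≈ φ (row (just Fin.zero))
      only-first = sumFun-const bools false once n
        (λ r y ry≢false → vanish (true ∷ᵥ r) (ℕ.s≤s (ℕₚ.≤-trans (one≤ (r y) ry≢false) (term≤sumℕ n _ y))))
        (λ r r≡false → resp λ { Fin.zero → refl ; (Fin.suc y) → r≡false y })
        where
        one≤ : ∀ b → b ≢ false → 1 ≤ (if b then 1 else 0)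
        one≤ true  _ = ℕₚ.≤-refl
        one≤ false b≢false = ⊥-elim (b≢false refl)
      shift-nothing : ∀ y → (false ∷ᵥ row nothing) y ≡ row nothing y
      shift-nothing Fin.zero    = refl
      shift-nothing (Fin.suc y) = refl
      shift-just : ∀ a y → (false ∷ᵥ row (just a)) y ≡ row (just (Fin.suc a)) y
      shift-just a Fin.zero    = refl
      shift-just a (Fin.suc y) = ≡.sym (==-suc a y)

  sumFun-rows : ∀ m n (Φ : (Fin m → Fin n → Bool) → Carrier) →
    (∀ {S S′} → (∀ x y → S x y ≡ S′ x y) → Φ S ≈ Φ S′) →
    (∀ S x → 2 ≤ sumℕ n (λ y → if S x y then 1 else 0) → Φ S ≈ 0#) →
    sumFun (allFuns bools n) m Φ ≈ sumFun (choices n) m (λ g → Φ (row ∘ g))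
  sumFun-rows ℕ.zero    n Φ resp vanish = resp λ ()
  sumFun-rows (suc m) n Φ resp vanish = begin
    sumMap (λ r → sumFun rows m (λ S → Φ (r ∷ᵥ S))) rows
      ≈⟨ sumMap-cong rows (λ r → sumFun-rows m n (λ S → Φ (r ∷ᵥ S)) (λ e → resp (∷-cong (λ _ → refl) e))
                                   (λ S x → vanish (r ∷ᵥ S) (Fin.suc x))) ⟩
    sumMap (λ r → sumFun (choices n) m (λ g → Φ (r ∷ᵥ row ∘ g))) rows
      ≈⟨ sumMap-sumFun-comm (choices n) m rows _ ⟩
    sumFun (choices n) m (λ g → sumMap (λ r → Φ (r ∷ᵥ row ∘ g)) rows)
      ≈⟨ sumFun-cong (choices n) m (λ g → sumMap-rows n (λ r → Φ (r ∷ᵥ row ∘ g))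
                        (λ e → resp (∷-cong e (λ _ _ → refl))) (λ r → vanish (r ∷ᵥ row ∘ g) Fin.zero)) ⟩
    sumFun (choices n) m (λ g → sumMap (λ o → Φ (row o ∷ᵥ row ∘ g)) (choices n))
      ≈⟨ sumMap-sumFun-comm (choices n) m (choices n) _ ⟨
    sumMap (λ o → sumFun (choices n) m (λ g → Φ (row o ∷ᵥ row ∘ g))) (choices n)
      ≈⟨ sumMap-cong (choices n) (λ o →
           sumFun-cong (choices n) m (λ g → resp λ { Fin.zero y → refl ; (Fin.suc x) y → refl })) ⟩
    sumFun (choices n) (suc m) (λ g → Φ (row ∘ g)) ∎
    where
    rows = allFuns bools n
    ∷-cong : ∀ {r r′ : Fin n → Bool} {S S′ : Fin m → Fin n → Bool} →
      (∀ y → r y ≡ r′ y) → (∀ x y → S x y ≡ S′ x y) → ∀ x y → (r ∷ᵥ S) x y ≡ (r′ ∷ᵥ S′) x y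
    ∷-cong er eS Fin.zero    y = er y
    ∷-cong er eS (Fin.suc x) y = eS x y

  module Forests {n : ℕ} (Γ : WDigraph R n) where

    open WDigraph Γ using (arc; weight)

    arcWeight : Fin n → Maybe (Fin n) → Carrier
    arcWeight x o = maybe′ (w R Γ x) 1# o

    funWeight : FunDigraph n → Carrier
    funWeight g = prodR R n (λ x → arcWeight x (g x))

    subgraphWeight-toSubgraph : ∀ g → subgraphWeight R Γ (toSubgraph g) ≈ funWeight g
    subgraphWeight-toSubgraph g = prodR-cong n (λ x → out-arc x (g x))
      where
      out-arc : ∀ x o → prodR R n (λ y → if row o y then w R Γ x y else 1#) ≈ arcWeight x o
      out-arc x nothing  = prodR-one n (λ _ → ≈-refl)
      out-arc x (just a) = trans
        (prodR-single n _ a (λ y y≢a → reflexive (≡.cong (λ b → if b then w R Γ x y else 1#) (==-≢ (y≢a ∘ ≡.sym)))))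
        (reflexive (≡.cong (λ b → if b then w R Γ x a else 1#) (==-refl a)))

    subgraphWeight-cong : ∀ {S S′} → S ≗₂ S′ → subgraphWeight R Γ S ≈ subgraphWeight R Γ S′
    subgraphWeight-cong e =
      prodR-cong n (λ x → prodR-cong n (λ y → reflexive (≡.cong (λ b → if b then w R Γ x y else 1#) (e x y))))

    subgraphWeight-¬sub : ∀ S → isSubgraphOfΓ R Γ S ≡ false → subgraphWeight R Γ S ≈ 0#
    subgraphWeight-¬sub S e with x , ex ← allB-false⁻ n e with y , exy ← allB-false⁻ n ex =
      prodR-zero n _ x (prodR-zero n _ y (missing (S x y) (arc x y) exy))
      where
      missing : ∀ s a → (not s ∨ a) ≡ false → (if s then (if a then weight x y else 0#) else 1#) ≈ 0#
      missing true false _ = ≈-refl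

    sum-subgraphs : ∀ (P : Subgraph n → Bool) → (∀ {S S′} → S ≗₂ S′ → P S ≡ P S′) →
      (∀ S → P S ≡ true → isInForest S ≡ true) →
      sumMap (λ S → if P S then subgraphWeight R Γ S else 0#) (subgraphs R Γ)
        ≈ sumFun (choices n) n (λ g → if P (toSubgraph g) then funWeight g else 0#)
    sum-subgraphs P P-cong P⇒forest = begin
      sumMap Φ (filterᵇ (isSubgraphOfΓ R Γ) (allFuns rows n))
        ≈⟨ sumMap-filterᵇ (isSubgraphOfΓ R Γ) (allFuns rows n) Φ ⟩
      sumMap (λ S → if isSubgraphOfΓ R Γ S then Φ S else 0#) (allFuns rows n)
        ≈⟨ sumMap-cong (allFuns rows n) (λ S → drop-¬sub S (isSubgraphOfΓ R Γ S) refl) ⟩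
      sumMap Φ (allFuns rows n)
        ≈⟨ sumMap-allFuns rows n (λ e → Φ-cong (λ x y → ≡.cong (λ r → r y) (e x))) ⟩
      sumFun rows n Φ
        ≈⟨ sumFun-rows n n Φ Φ-cong vanish ⟩
      sumFun (choices n) n (Φ ∘ toSubgraph)
        ≈⟨ sumFun-cong (choices n) n (λ g → if-cong refl (subgraphWeight-toSubgraph g)) ⟩
      sumFun (choices n) n (λ g → if P (toSubgraph g) then funWeight g else 0#) ∎
      where
      rows = allFuns bools n
      Φ : Subgraph n → Carrier
      Φ S = if P S then subgraphWeight R Γ S else 0#
      Φ-cong : ∀ {S S′} → S ≗₂ S′ → Φ S ≈ Φ S′
      Φ-cong e = if-cong (P-cong e) (subgraphWeight-cong e)
      drop-¬sub : ∀ S b → isSubgraphOfΓ R Γ S ≡ b → (if b then Φ S else 0#) ≈ Φ S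
      drop-¬sub S true  _ = ≈-refl
      drop-¬sub S false e with P S
      ... | true  = sym (subgraphWeight-¬sub S e)
      ... | false = ≈-refl
      vanish : ∀ S x → 2 ≤ outdeg S x → Φ S ≈ 0#
      vanish S x 2≤out with P S in eq
      ... | false = ≈-refl
      ... | true  = ⊥-elim (ℕₚ.<-irrefl refl (ℕₚ.≤-trans 2≤out (ℕₚ.≤ᵇ⇒≤ _ 1 (≡⇒T
                      (allB-true⁻ n (∧-trueˡ _ (P⇒forest S eq)) x)))))

    forestTerm : ℕ → FunDigraph n → Carrier
    forestTerm k g = if isForest g ∧ (arcCount g ℕ.≡ᵇ k) then funWeight g else 0#

    rootedTerm : ℕ → Fin n → Fin n → FunDigraph n → Carrier
    rootedTerm k i j g = if isForest g ∧ ((arcCount g ℕ.≡ᵇ k) ∧ (walk g n i == j)) then funWeight g else 0#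

    σ-forests : ∀ k → σ R Γ k ≈ sumFun (choices n) n (forestTerm k)
    σ-forests k = trans (sum-subgraphs _ P-cong (λ S → ∧-trueˡ (isInForest S)))
      (sumFun-cong (choices n) n (λ g →
        if-cong (≡.cong₂ _∧_ (isInForest-toSubgraph g) (≡.cong (ℕ._≡ᵇ k) (numArcs-toSubgraph g))) ≈-refl))
      where
      P-cong : ∀ {S S′} → S ≗₂ S′ →
        isInForest S ∧ (numArcs S ℕ.≡ᵇ k) ≡ isInForest S′ ∧ (numArcs S′ ℕ.≡ᵇ k)
      P-cong e = ≡.cong₂ _∧_ (isInForest-cong e) (≡.cong (ℕ._≡ᵇ k) (numArcs-cong e))

    Q-forests : ∀ k i j → Q R Γ k i j ≈ sumFun (choices n) n (rootedTerm k i j)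
    Q-forests k i j = trans (sum-subgraphs _ P-cong (λ S → ∧-trueˡ (isInForest S)))
      (sumFun-cong (choices n) n (λ g → if-cong (P-toSubgraph g) ≈-refl))
      where
      P-cong : ∀ {S S′} → S ≗₂ S′ → isInForest S ∧ ((numArcs S ℕ.≡ᵇ k) ∧ isRootOf S i j)
                                   ≡ isInForest S′ ∧ ((numArcs S′ ℕ.≡ᵇ k) ∧ isRootOf S′ i j)
      P-cong e = ≡.cong₂ _∧_ (isInForest-cong e) (≡.cong₂ _∧_ (≡.cong (ℕ._≡ᵇ k) (numArcs-cong e)) (isRootOf-cong e i j))
      P-toSubgraph : ∀ g → isInForest (toSubgraph g) ∧ ((numArcs (toSubgraph g) ℕ.≡ᵇ k) ∧ isRootOf (toSubgraph g) i j)
                           ≡ isForest g ∧ ((arcCount g ℕ.≡ᵇ k) ∧ (walk g n i == j))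
      P-toSubgraph g rewrite isInForest-toSubgraph g | numArcs-toSubgraph g with isForest g in forest
      ... | false = refl
      ... | true  = ≡.cong ((arcCount g ℕ.≡ᵇ k) ∧_) (isRootOf-forest g forest i j)

    -- The forest recurrence

    rowWeight : Fin n → Fin n → Carrier
    rowWeight i l = if l == i then 0# else w R Γ i l

    -- (L c) i = Σ_l w i l · (c i - c l), in additive form, where w i l may be replaced by u l wherever c l = c i.
    laplacian-row : ∀ i (c u : Fin n → Carrier) → (∀ l → rowWeight i l ≡ u l ⊎ c l ≈ c i) →
      ∑[ l < n ] (laplacian R Γ i l * c l) + ∑[ l < n ] (u l * c l) ≈ (∑[ l < n ] u l) * c i
    laplacian-row i c u same = ∙-cancelʳ (sum v * c i) _ _ (begin
      (sum Lc + sum uc) + sum v * c i    ≈⟨ +-assoc _ _ _ ⟩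
      sum Lc + (sum uc + sum v * c i)    ≈⟨ +-congˡ swap-weights ⟩
      sum Lc + (sum vc + sum u * c i)    ≈⟨ +-assoc _ _ _ ⟨
      (sum Lc + sum vc) + sum u * c i    ≈⟨ +-congʳ degree ⟩
      sum v * c i + sum u * c i          ≈⟨ +-comm _ _ ⟩
      sum u * c i + sum v * c i          ∎)
      where
      v Lc uc vc : Fin n → Carrier
      v = rowWeight i
      Lc l = laplacian R Γ i l * c l
      uc l = u l * c l
      vc l = v l * c l
      degree : sum Lc + sum vc ≈ sum v * c i
      degree = trans (sym (∑-distrib-+ Lc vc)) (trans (∑-single n _ i off-diagonal) diagonal)
        where
        off-diagonal : ∀ l → l ≢ i → Lc l + vc l ≈ 0#
        off-diagonal l l≢i rewrite ==-≢ (l≢i ∘ ≡.sym) | ==-≢ l≢i =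
          trans (+-congʳ (sym (-‿distribˡ-* _ _))) (-‿inverseˡ _)
        diagonal : Lc i + vc i ≈ sum v * c i
        diagonal rewrite ==-refl i = trans (+-cong (*-congʳ (reflexive (sumR≡∑ n v))) (zeroˡ _)) (+-identityʳ _)
      swap-weights : sum uc + sum v * c i ≈ sum vc + sum u * c i
      swap-weights = begin
        sum uc + sum v * c i              ≈⟨ +-congˡ (*-distribʳ-sum (c i) v) ⟩
        sum uc + sum (λ l → v l * c i)    ≈⟨ ∑-distrib-+ uc _ ⟨
        sum (λ l → uc l + v l * c i)      ≈⟨ sum-cong-≋ pointwise ⟩
        sum (λ l → vc l + u l * c i)      ≈⟨ ∑-distrib-+ vc _ ⟩
        sum vc + sum (λ l → u l * c i)    ≈⟨ +-congˡ (*-distribʳ-sum (c i) u) ⟨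
        sum vc + sum u * c i              ∎
        where
        pointwise : ∀ l → uc l + v l * c i ≈ vc l + u l * c i
        pointwise l with same l
        ... | inj₁ v≡u rewrite v≡u = ≈-refl
        ... | inj₂ cl≈ci = trans (+-cong (*-congˡ cl≈ci) (*-congˡ (sym cl≈ci))) (+-comm _ _)

    recurrenceTermˡ recurrenceTermʳ : ℕ → Fin n → Fin n → FunDigraph n → Carrier
    recurrenceTermˡ k i j g = rootedTerm (suc k) i j g + ∑[ l < n ] (laplacian R Γ i l * rootedTerm k l j g)
    recurrenceTermʳ k i j g = forestTerm (suc k) g * idM R i j

    forestTerm-forest : ∀ g {N W} K → isForest g ≡ true → arcCount g ≡ N → funWeight g ≈ W →
      forestTerm K g ≈ 𝟙 (N ℕ.≡ᵇ K) * W
    forestTerm-forest g K forest refl w≈ rewrite forest = trans (𝟙-if _ _) (*-congˡ w≈)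

    rootedTerm-forest : ∀ g {N W r} K l j → isForest g ≡ true → arcCount g ≡ N → funWeight g ≈ W → walk g n l ≡ r →
      rootedTerm K l j g ≈ 𝟙 (N ℕ.≡ᵇ K) * (𝟙 (r == j) * W)
    rootedTerm-forest g {N} K l j forest refl w≈ refl rewrite forest with N ℕ.≡ᵇ K
    ... | true  = trans (𝟙-if _ _) (trans (*-congˡ w≈) (sym (*-identityˡ _)))
    ... | false = sym (zeroˡ _)

    forestTerm-¬forest : ∀ g K → isForest g ≡ false → forestTerm K g ≈ 0#
    forestTerm-¬forest g K ¬forest rewrite ¬forest = ≈-refl

    rootedTerm-¬forest : ∀ g K l j → isForest g ≡ false → rootedTerm K l j g ≈ 0#
    rootedTerm-¬forest g K l j ¬forest rewrite ¬forest = ≈-refl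

  -- The functional digraphs that agree with g′ off the vertex i.
  module Fiber {n′ : ℕ} (Γ : WDigraph R (suc n′)) (k : ℕ) (i j : Fin (suc n′))
               (g′ : Vector (Maybe (Fin (suc n′))) n′) where

    open Forests Γ

    f : Maybe (Fin (suc n′)) → FunDigraph (suc n′)
    f o = insert i o g′

    N′ : ℕ
    N′ = sumℕ n′ (λ x → if is-just (g′ x) then 1 else 0)

    W′ : Carrier
    W′ = prodR R n′ (λ x → arcWeight (punchIn i x) (g′ x))

    arcCount-f : ∀ o → arcCount (f o) ≡ (if is-just o then 1 else 0) ℕ.+ N′
    arcCount-f o = sumℕ-insert n′ (λ _ o → if is-just o then 1 else 0) i o g′

    funWeight-f : ∀ o → funWeight (f o) ≈ arcWeight i o * W′
    funWeight-f o = trans (prodR-remove n′ (λ x → arcWeight x (f o x)) i)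
      (*-cong (reflexive (≡.cong (arcWeight i) (insert-at i o g′)))
              (prodR-cong n′ (λ x → reflexive (≡.cong (arcWeight (punchIn i x)) (insert-punchIn i o g′ x)))))

    module Redirected (a : Fin (suc n′)) = Redirect (f nothing) (f (just a)) i a
      (insert-at i nothing g′) (insert-at i (just a) g′) (λ x x≢i → insert-≢ i (just a) nothing g′ x x≢i)

    fiberSum : (FunDigraph (suc n′) → Carrier) → Carrier
    fiberSum ψ = sumMap (ψ ∘ f) (choices (suc n′))

    Ψ₁ Ψ₂ : FunDigraph (suc n′) → Carrier
    Ψ₁ = recurrenceTermˡ k i j
    Ψ₂ = recurrenceTermʳ k i j

    Ψ-¬forest : ∀ g → isForest g ≡ false → Ψ₁ g ≈ 0# × Ψ₂ g ≈ 0#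
    Ψ-¬forest g ¬forest =
      trans (+-cong (rootedTerm-¬forest g (suc k) i j ¬forest)
                    (∑-zero (suc n′) (λ l → trans (*-congˡ (rootedTerm-¬forest g k l j ¬forest)) (zeroʳ (laplacian R Γ i l)))))
            (+-identityʳ 0#) ,
      trans (*-congʳ (forestTerm-¬forest g (suc k) ¬forest)) (zeroˡ _)

    fiber-¬forest : isForest (f nothing) ≡ false → fiberSum Ψ₁ ≈ fiberSum Ψ₂
    fiber-¬forest ¬forest = trans (sumMap-zero (choices (suc n′)) (λ o → proj₁ (Ψ-¬forest (f o) (¬forest-f o))))
                                  (sym (sumMap-zero (choices (suc n′)) (λ o → proj₂ (Ψ-¬forest (f o) (¬forest-f o)))))
      where
      ¬forest-f : ∀ o → isForest (f o) ≡ false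
      ¬forest-f nothing  = ¬forest
      ¬forest-f (just a) with isForest (f (just a)) in forest
      ... | false = refl
      ... | true with () ← ≡.trans (≡.sym ¬forest)
                      (IsForest⇒isForest (f nothing) (Redirected.forest-before a (isForest⇒IsForest (f (just a)) forest)))

    module _ (forest : isForest (f nothing) ≡ true) where

      -- ρ maps each vertex to its root in f nothing, ρ[ a ] to its root once i points to a; u a is the
      -- weight of the arc i → a, or 0 when that arc closes a cycle.
      ρ : Fin (suc n′) → Fin (suc n′)
      ρ = walk (f nothing) (suc n′)

      ρ-root : ρ i ≡ i
      ρ-root = walk-root (f nothing) (suc n′) (insert-at i nothing g′)

      ρ[_] : Fin (suc n′) → Fin (suc n′) → Fin (suc n′)
      ρ[ a ] l = if ρ l == i then ρ a else ρ l

      u x : Fin (suc n′) → Carrier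
      u a = if ρ a == i then 0# else w R Γ i a
      x l = 𝟙 (ρ l == j)

      x[_] : Fin (suc n′) → Fin (suc n′) → Carrier
      x[ a ] l = 𝟙 (ρ[ a ] l == j)

      E : ℕ → ℕ → Carrier
      E N K = 𝟙 (N ℕ.≡ᵇ K) * W′

      ΣL : (Fin (suc n′) → Carrier) → Carrier
      ΣL d = ∑[ l < suc n′ ] (laplacian R Γ i l * d l)

      rooted-nothing : ∀ K l → rootedTerm K l j (f nothing) ≈ E N′ K * x l
      rooted-nothing K l = trans (rootedTerm-forest (f nothing) K l j forest (arcCount-f nothing)
                                    (trans (funWeight-f nothing) (*-identityˡ W′)) refl)
                                 (x*yz≈xz*y _ _ _)

      forest-nothing : ∀ K → forestTerm K (f nothing) ≈ E N′ K
      forest-nothing K = forestTerm-forest (f nothing) K forest (arcCount-f nothing) (trans (funWeight-f nothing) (*-identityˡ W′))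

      rooted-just : ∀ K l a → rootedTerm K l j (f (just a)) ≈ E (suc N′) K * (u a * x[ a ] l)
      rooted-just K l a with ρ a Fin.≟ i
      ... | yes ρa≡i =
        trans (rootedTerm-¬forest (f (just a)) K l j (non-root⇒¬isForest (f (just a)) i (Redirected.cycle a ρa≡i)))
              (sym (trans (*-congˡ (zeroˡ _)) (zeroʳ _)))
      ... | no ρa≢i =
        trans (rootedTerm-forest (f (just a)) K l j (IsForest⇒isForest (f (just a)) (proj₁ ∘ after)) (arcCount-f (just a))
                                 (funWeight-f (just a)) (proj₂ (after l)))
              (solve 4 (λ p q r s → p :* (q :* (r :* s)) := (p :* s) :* (r :* q)) ≈-refl _ _ _ _)
        where after = Redirected.forest-after a (isForest⇒IsForest (f nothing) forest) ρa≢i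

      forest-just : ∀ K a → forestTerm K (f (just a)) ≈ E (suc N′) K * u a
      forest-just K a with ρ a Fin.≟ i
      ... | yes ρa≡i =
        trans (forestTerm-¬forest (f (just a)) K (non-root⇒¬isForest (f (just a)) i (Redirected.cycle a ρa≡i)))
              (sym (zeroʳ _))
      ... | no ρa≢i =
        trans (forestTerm-forest (f (just a)) K (IsForest⇒isForest (f (just a)) (proj₁ ∘ after)) (arcCount-f (just a))
                                 (funWeight-f (just a)))
              (solve 3 (λ p r s → p :* (r :* s) := (p :* s) :* r) ≈-refl _ _ _)
        where after = Redirected.forest-after a (isForest⇒IsForest (f nothing) forest) ρa≢i

      ρ[]-moved : ∀ a l → ρ l ≡ i → ρ[ a ] l ≡ ρ a
      ρ[]-moved a l ρl≡i rewrite ==-≡ ρl≡i = refl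

      x[]-root : ∀ a → x[ a ] i ≡ x a
      x[]-root a = ≡.cong (λ z → 𝟙 (z == j)) (ρ[]-moved a i ρ-root)

      x-root : x i ≡ idM R i j
      x-root = ≡.cong (λ z → 𝟙 (z == j)) ρ-root

      rowWeight-u : ∀ l → ρ l ≢ i → rowWeight i l ≡ u l
      rowWeight-u l ρl≢i rewrite ==-≢ ρl≢i | ==-≢ (λ l≡i → ρl≢i (≡.trans (≡.cong ρ l≡i) ρ-root)) = refl

      laplacian-row-ρ : ∀ (d : Fin (suc n′) → Carrier) → (∀ l → ρ l ≡ i → d l ≈ d i) →
        ΣL d + ∑[ l < suc n′ ] (u l * d l) ≈ (∑[ l < suc n′ ] u l) * d i
      laplacian-row-ρ d fixed = laplacian-row i d u (λ l → choose l (ρ l Fin.≟ i))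
        where
        choose : ∀ l → Dec (ρ l ≡ i) → rowWeight i l ≡ u l ⊎ d l ≈ d i
        choose l (yes ρl≡i) = inj₂ (fixed l ρl≡i)
        choose l (no  ρl≢i) = inj₁ (rowWeight-u l ρl≢i)

      S : Carrier
      S = ∑[ l < suc n′ ] (u l * x l)

      laplacian-x : ΣL x + S ≈ sum u * idM R i j
      laplacian-x = trans
        (laplacian-row-ρ x (λ l ρl≡i → reflexive (≡.cong (λ z → 𝟙 (z == j)) (≡.trans ρl≡i (≡.sym ρ-root)))))
        (*-congˡ (reflexive x-root))

      laplacian-x[] : ∀ a → ΣL x[ a ] + S ≈ sum u * x a
      laplacian-x[] a = trans (+-congˡ (sum-cong-≋ same-terms)) (trans
        (laplacian-row-ρ x[ a ] (λ l ρl≡i →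
          reflexive (≡.cong (λ z → 𝟙 (z == j)) (≡.trans (ρ[]-moved a l ρl≡i) (≡.sym (ρ[]-moved a i ρ-root))))))
        (*-congˡ (reflexive (x[]-root a))))
        where
        same-terms : ∀ l → u l * x l ≈ u l * x[ a ] l
        same-terms l with ρ l Fin.≟ i
        ... | yes ρl≡i = trans (zeroˡ _) (sym (zeroˡ _))
        ... | no  _    = ≈-refl

      -- Weighted by u, the identities laplacian-x[] sum to sum u * S on both sides.
      laplacian-x[]-cancel : ∑[ a < suc n′ ] (u a * ΣL x[ a ]) ≈ 0#
      laplacian-x[]-cancel = ∙-cancelʳ (sum u * S) _ _ (begin
        ∑[ a < suc n′ ] (u a * ΣL x[ a ]) + sum u * S
          ≈⟨ +-congˡ (*-distribʳ-sum S u) ⟩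
        ∑[ a < suc n′ ] (u a * ΣL x[ a ]) + ∑[ a < suc n′ ] (u a * S)
          ≈⟨ ∑-distrib-+ (λ a → u a * ΣL x[ a ]) (λ a → u a * S) ⟨
        ∑[ a < suc n′ ] (u a * ΣL x[ a ] + u a * S)
          ≈⟨ sum-cong-≋ (λ a → trans (sym (distribˡ (u a) _ _)) (*-congˡ (laplacian-x[] a))) ⟩
        ∑[ a < suc n′ ] (u a * (sum u * x a))
          ≈⟨ sum-cong-≋ (λ a → x*yz≈y*xz (u a) (sum u) (x a)) ⟩
        ∑[ a < suc n′ ] (sum u * (u a * x a))
          ≈⟨ *-distribˡ-sum (sum u) (λ a → u a * x a) ⟨
        sum u * S
          ≈⟨ +-identityˡ _ ⟨
        0# + sum u * S
          ∎)

      fiber-forest : fiberSum Ψ₁ ≈ fiberSum Ψ₂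
      fiber-forest = begin
        fiberSum Ψ₁
          ≈⟨ sumMap-choices (suc n′) (Ψ₁ ∘ f) ⟩
        Ψ₁ (f nothing) + ∑[ a < suc n′ ] Ψ₁ (f (just a))
          ≈⟨ +-cong Ψ₁-nothing
                    (trans (sum-cong-≋ Ψ₁-just) (∑-distrib-+ (λ a → E₁ * (u a * x a)) (λ a → E₀ * (u a * ΣL x[ a ])))) ⟩
        (E₂ * δ + E₁ * ΣL x) + (∑[ a < suc n′ ] (E₁ * (u a * x a)) + ∑[ a < suc n′ ] (E₀ * (u a * ΣL x[ a ])))
          ≈⟨ +-congˡ (+-cong (*-distribˡ-sum E₁ (λ a → u a * x a)) (*-distribˡ-sum E₀ (λ a → u a * ΣL x[ a ]))) ⟨
        (E₂ * δ + E₁ * ΣL x) + (E₁ * S + E₀ * ∑[ a < suc n′ ] (u a * ΣL x[ a ]))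
          ≈⟨ +-congˡ (trans (+-congˡ (trans (*-congˡ laplacian-x[]-cancel) (zeroʳ E₀))) (+-identityʳ _)) ⟩
        (E₂ * δ + E₁ * ΣL x) + E₁ * S
          ≈⟨ trans (+-assoc _ _ _) (+-congˡ (sym (distribˡ E₁ _ _))) ⟩
        E₂ * δ + E₁ * (ΣL x + S)
          ≈⟨ +-congˡ (*-congˡ laplacian-x) ⟩
        E₂ * δ + E₁ * (sum u * δ)
          ≈⟨ +-congˡ (trans (*-congˡ (*-distribʳ-sum δ u)) (*-distribˡ-sum E₁ (λ a → u a * δ))) ⟩
        E₂ * δ + ∑[ a < suc n′ ] (E₁ * (u a * δ))
          ≈⟨ +-cong (*-congʳ (forest-nothing (suc k)))
                    (sum-cong-≋ (λ a → trans (*-congʳ (forest-just (suc k) a)) (*-assoc E₁ (u a) δ))) ⟨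
        Ψ₂ (f nothing) + ∑[ a < suc n′ ] Ψ₂ (f (just a))
          ≈⟨ sumMap-choices (suc n′) (Ψ₂ ∘ f) ⟨
        fiberSum Ψ₂ ∎
        where
        δ E₀ E₁ E₂ : Carrier
        δ = idM R i j
        E₀ = E (suc N′) k
        E₁ = E N′ k
        E₂ = E N′ (suc k)
        Ψ₁-nothing : Ψ₁ (f nothing) ≈ E₂ * δ + E₁ * ΣL x
        Ψ₁-nothing = +-cong (trans (rooted-nothing (suc k) i) (*-congˡ (reflexive x-root)))
          (trans (sum-cong-≋ (λ l → trans (*-congˡ (rooted-nothing k l)) (x*yz≈y*xz (laplacian R Γ i l) E₁ (x l))))
                 (sym (*-distribˡ-sum E₁ (λ l → laplacian R Γ i l * x l))))
        Ψ₁-just : ∀ a → Ψ₁ (f (just a)) ≈ E₁ * (u a * x a) + E₀ * (u a * ΣL x[ a ])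
        Ψ₁-just a = +-cong (trans (rooted-just (suc k) i a) (*-congˡ (*-congˡ (reflexive (x[]-root a)))))
          (begin
            ∑[ l < suc n′ ] (laplacian R Γ i l * rootedTerm k l j (f (just a)))
              ≈⟨ sum-cong-≋ (λ l → trans (*-congˡ (rooted-just k l a))
                   (trans (x*yz≈y*xz (laplacian R Γ i l) E₀ (u a * x[ a ] l))
                          (*-congˡ (x*yz≈y*xz (laplacian R Γ i l) (u a) (x[ a ] l))))) ⟩
            ∑[ l < suc n′ ] (E₀ * (u a * (laplacian R Γ i l * x[ a ] l)))
              ≈⟨ *-distribˡ-sum E₀ (λ l → u a * (laplacian R Γ i l * x[ a ] l)) ⟨
            E₀ * ∑[ l < suc n′ ] (u a * (laplacian R Γ i l * x[ a ] l))
              ≈⟨ *-congˡ (*-distribˡ-sum (u a) (λ l → laplacian R Γ i l * x[ a ] l)) ⟨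
            E₀ * (u a * ΣL x[ a ]) ∎)

    fiber-identity : fiberSum Ψ₁ ≈ fiberSum Ψ₂
    fiber-identity = by-cases (isForest (f nothing)) refl
      where
      by-cases : ∀ b → isForest (f nothing) ≡ b → fiberSum Ψ₁ ≈ fiberSum Ψ₂
      by-cases true  forest = fiber-forest forest
      by-cases false ¬forest = fiber-¬forest ¬forest

  Q-suc+LQ : ∀ {n} (Γ : WDigraph R n) k i j →
    Q R Γ (suc k) i j + ∑[ l < n ] (laplacian R Γ i l * Q R Γ k l j) ≈ σ R Γ (suc k) * idM R i j
  Q-suc+LQ {suc n′} Γ k i j = begin
    Q R Γ (suc k) i j + ∑[ l < n ] (laplacian R Γ i l * Q R Γ k l j)
      ≈⟨ +-cong (Q-forests (suc k) i j)
                (sum-cong-≋ (λ l → trans (*-congˡ (Q-forests k l j))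
                                         (*-distribˡ-sumFun (choices n) n (laplacian R Γ i l) (rootedTerm k l j)))) ⟩
    ΣG (rootedTerm (suc k) i j) + ∑[ l < n ] ΣG (λ g → laplacian R Γ i l * rootedTerm k l j g)
      ≈⟨ +-congˡ (sumFun-∑-comm (choices n) n n (λ g l → laplacian R Γ i l * rootedTerm k l j g)) ⟨
    ΣG (rootedTerm (suc k) i j) + ΣG (λ g → ∑[ l < n ] (laplacian R Γ i l * rootedTerm k l j g))
      ≈⟨ sumFun-+ (choices n) n (rootedTerm (suc k) i j) (λ g → ∑[ l < n ] (laplacian R Γ i l * rootedTerm k l j g)) ⟨
    ΣG (recurrenceTermˡ k i j)
      ≈⟨ by-fibers (recurrenceTermˡ k i j) ⟩
    sumFun (choices n) n′ (λ g′ → sumMap (λ o → recurrenceTermˡ k i j (insert i o g′)) (choices n))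
      ≈⟨ sumFun-cong (choices n) n′ (λ g′ → Fiber.fiber-identity Γ k i j g′) ⟩
    sumFun (choices n) n′ (λ g′ → sumMap (λ o → recurrenceTermʳ k i j (insert i o g′)) (choices n))
      ≈⟨ by-fibers (recurrenceTermʳ k i j) ⟨
    ΣG (λ g → forestTerm (suc k) g * idM R i j)
      ≈⟨ sumFun-cong (choices n) n (λ g → *-comm (forestTerm (suc k) g) (idM R i j)) ⟩
    ΣG (λ g → idM R i j * forestTerm (suc k) g)
      ≈⟨ *-distribˡ-sumFun (choices n) n (idM R i j) (forestTerm (suc k)) ⟨
    idM R i j * ΣG (forestTerm (suc k))
      ≈⟨ *-comm (idM R i j) (ΣG (forestTerm (suc k))) ⟩
    ΣG (forestTerm (suc k)) * idM R i j
      ≈⟨ *-congʳ (σ-forests (suc k)) ⟨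
    σ R Γ (suc k) * idM R i j ∎
    where
    open Forests Γ
    n = suc n′
    ΣG : (FunDigraph n → Carrier) → Carrier
    ΣG = sumFun (choices n) n
    by-fibers : ∀ ψ → ΣG ψ ≈ sumFun (choices n) n′ (λ g′ → sumMap (λ o → ψ (insert i o g′)) (choices n))
    by-fibers ψ = trans (sumFun-insert (choices n) n′ i ψ)
                        (sumMap-sumFun-comm (choices n) n′ (choices n) (λ o g′ → ψ (insert i o g′)))

  Q-recurrence : ∀ {n} (Γ : WDigraph R n) k i j →
    Q R Γ (suc k) i j ≈ σ R Γ (suc k) * idM R i j + mulM R (negM R (laplacian R Γ)) (Q R Γ k) i j
  Q-recurrence {n} Γ k i j = trans (x≈z//y (Q R Γ (suc k) i j) _ _ (Q-suc+LQ Γ k i j)) (+-congˡ (begin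
    - ∑[ l < n ] (laplacian R Γ i l * Q R Γ k l j)    ≈⟨ ∑-neg n (λ l → laplacian R Γ i l * Q R Γ k l j) ⟨
    ∑[ l < n ] (- (laplacian R Γ i l * Q R Γ k l j))  ≈⟨ sum-cong-≋ {n} (λ l → -‿distribˡ-* _ (Q R Γ k l j)) ⟩
    ∑[ l < n ] (- laplacian R Γ i l * Q R Γ k l j)    ≡⟨ sumR≡∑ n (λ l → - laplacian R Γ i l * Q R Γ k l j) ⟨
    mulM R (negM R (laplacian R Γ)) (Q R Γ k) i j      ∎))

  Q-zero : ∀ {n} (Γ : WDigraph R n) i j → Q R Γ 0 i j ≈ idM R i j
  Q-zero {n} Γ i j = trans (Q-forests 0 i j) (sumFun-const (choices n) nothing once n vanish value)
    where
    open Forests Γ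
    once : ∀ (h : Maybe (Fin n) → Carrier) → (∀ o → o ≢ nothing → h o ≈ 0#) → sumMap h (choices n) ≈ h nothing
    once h h≈0 = trans (sumMap-choices n h) (trans (+-congˡ (∑-zero n (λ a → h≈0 (just a) λ ()))) (+-identityʳ _))
    vanish : ∀ g x → g x ≢ nothing → rootedTerm 0 i j g ≈ 0#
    vanish g x gx≢nothing with arcCount g in count
    ... | suc _  rewrite Boolₚ.∧-zeroʳ (isForest g) = ≈-refl
    ... | ℕ.zero = ⊥-elim (gx≢nothing (no-arc (g x) (sumℕ-zero⁻ n _ count x)))
      where
      no-arc : ∀ o → (if is-just o then 1 else 0) ≡ 0 → o ≡ nothing
      no-arc nothing _ = refl
    value : ∀ g → (∀ x → g x ≡ nothing) → rootedTerm 0 i j g ≈ idM R i j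
    value g none = trans
      (rootedTerm-forest g 0 i j (IsForest⇒isForest g (λ x → none _))
                         (sumℕ-zero n (λ x → ≡.cong (λ o → if is-just o then 1 else 0) (none x)))
                         (prodR-one n (λ x → reflexive (≡.cong (arcWeight x) (none x))))
                         (walk-root g n (none i)))
      (trans (*-identityˡ _) (*-identityʳ _))

  -- Powers of a matrix from a matrix recurrence

  module _ {n : ℕ} (A : Matrix R n) (s α : ℕ → Carrier) (P : ℕ → Matrix R n)
           (P-zero : ∀ i j → P 0 i j ≈ idM R i j)
           (P-suc : ∀ k i j → P (suc k) i j ≈ s (suc k) * idM R i j + mulM R A (P k) i j)
           (α-zero : α 0 ≈ 1#)
           (α-suc : ∀ m → α (suc m) ≈ - ∑[ k < suc m ] (α (toℕ k) * s (suc m ∸ toℕ k))) where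

    powM-expansion : ∀ m i j → powM R A m i j ≈ ∑[ k < suc m ] (α (toℕ k) * P (m ∸ toℕ k) i j)
    powM-expansion ℕ.zero    i j = sym (trans (+-identityʳ _) (trans (*-cong α-zero (P-zero i j)) (*-identityˡ _)))
    powM-expansion (suc m) i j = begin
      sumR R n (λ l → A i l * powM R A m l j)
        ≡⟨ sumR≡∑ n (λ l → A i l * powM R A m l j) ⟩
      ∑[ l < n ] (A i l * powM R A m l j)
        ≈⟨ sum-cong-≋ {n} (λ l → trans (*-congˡ (powM-expansion m l j))
              (trans (*-distribˡ-sum {suc m} (A i l) (λ k → α (toℕ k) * P (m ∸ toℕ k) l j))
                     (sum-cong-≋ {suc m} (λ k → x*yz≈y*xz (A i l) (α (toℕ k)) (P (m ∸ toℕ k) l j))))) ⟩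
      ∑[ l < n ] ∑[ k < suc m ] (α (toℕ k) * (A i l * P (m ∸ toℕ k) l j))
        ≈⟨ ∑-comm {n} {suc m} (λ l k → α (toℕ k) * (A i l * P (m ∸ toℕ k) l j)) ⟩
      ∑[ k < suc m ] ∑[ l < n ] (α (toℕ k) * (A i l * P (m ∸ toℕ k) l j))
        ≈⟨ sum-cong-≋ {suc m} (λ k → trans (sym (*-distribˡ-sum {n} (α (toℕ k)) (λ l → A i l * P (m ∸ toℕ k) l j)))
                                           (*-congˡ (reflexive (≡.sym (sumR≡∑ n (λ l → A i l * P (m ∸ toℕ k) l j)))))) ⟩
      ∑[ k < suc m ] (α (toℕ k) * M k)
        ≈⟨ +-identityʳ _ ⟨
      ∑[ k < suc m ] (α (toℕ k) * M k) + 0#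
        ≈⟨ +-congˡ (-‿inverseʳ (Σs * δ)) ⟨
      ∑[ k < suc m ] (α (toℕ k) * M k) + (Σs * δ + - (Σs * δ))
        ≈⟨ trans (sym (+-assoc _ _ _)) (+-congʳ (+-comm _ _)) ⟩
      (Σs * δ + ∑[ k < suc m ] (α (toℕ k) * M k)) + - (Σs * δ)
        ≈⟨ +-cong (+-congʳ (*-distribʳ-sum {suc m} δ (λ k → α (toℕ k) * s (suc m ∸ toℕ k)))) (-‿distribˡ-* Σs δ) ⟩
      (∑[ k < suc m ] (α (toℕ k) * s (suc m ∸ toℕ k) * δ) + ∑[ k < suc m ] (α (toℕ k) * M k)) + - Σs * δ
        ≈⟨ +-cong (trans (sym (∑-distrib-+ {suc m} (λ k → α (toℕ k) * s (suc m ∸ toℕ k) * δ)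
                                                   (λ k → α (toℕ k) * M k)))
                         (sum-cong-≋ {suc m} recurrence))
                  (*-cong (sym (α-suc m)) (sym (P-zero i j))) ⟩
      ∑[ k < suc m ] (α (toℕ k) * P (suc m ∸ toℕ k) i j) + α (suc m) * P 0 i j
        ≈⟨ +-congˡ (*-congˡ (reflexive (≡.cong (λ t → P t i j) (ℕₚ.n∸n≡0 m)))) ⟨
      ∑[ k < suc m ] (α (toℕ k) * P (suc m ∸ toℕ k) i j) + α (suc m) * P (suc m ∸ suc m) i j
        ≈⟨ ∑-toℕ-last (suc m) (λ t → α t * P (suc m ∸ t) i j) ⟨
      ∑[ k < suc (suc m) ] (α (toℕ k) * P (suc m ∸ toℕ k) i j) ∎
      where
      δ Σs : Carrier
      δ = idM R i j
      Σs = ∑[ k < suc m ] (α (toℕ k) * s (suc m ∸ toℕ k))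
      M : Fin (suc m) → Carrier
      M k = mulM R A (P (m ∸ toℕ k)) i j
      recurrence : ∀ k → α (toℕ k) * s (suc m ∸ toℕ k) * δ + α (toℕ k) * M k ≈ α (toℕ k) * P (suc m ∸ toℕ k) i j
      recurrence k = begin
        α (toℕ k) * s (suc m ∸ toℕ k) * δ + α (toℕ k) * M k    ≈⟨ +-congʳ (*-assoc _ _ _) ⟩
        α (toℕ k) * (s (suc m ∸ toℕ k) * δ) + α (toℕ k) * M k  ≈⟨ distribˡ _ _ _ ⟨
        α (toℕ k) * (s (suc m ∸ toℕ k) * δ + M k)              ≡⟨ ≡.cong (λ t → α (toℕ k) * (s t * δ + M k)) suc-∸ ⟩
        α (toℕ k) * (s (suc (m ∸ toℕ k)) * δ + M k)            ≈⟨ *-congˡ (P-suc (m ∸ toℕ k) i j) ⟨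
        α (toℕ k) * P (suc (m ∸ toℕ k)) i j                    ≡⟨ ≡.cong (λ t → α (toℕ k) * P t i j) suc-∸ ⟨
        α (toℕ k) * P (suc m ∸ toℕ k) i j                      ∎
        where
        suc-∸ : suc m ∸ toℕ k ≡ suc (m ∸ toℕ k)
        suc-∸ = ℕₚ.+-∸-assoc 1 (Finₚ.toℕ≤pred[n] k)

  -- The recurrence for α

  fromℕ-+ : ∀ a b → fromℕ R (a ℕ.+ b) ≈ fromℕ R a + fromℕ R b
  fromℕ-+ ℕ.zero    b = sym (+-identityˡ _)
  fromℕ-+ (suc a) b = trans (+-congˡ (fromℕ-+ a b)) (sym (+-assoc _ _ _))

  fromℕ-sumℕ : ∀ K (h : Vector ℕ K) → fromℕ R (sumℕ K h) ≈ ∑[ t < K ] fromℕ R (h t)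
  fromℕ-sumℕ ℕ.zero    h = ≈-refl
  fromℕ-sumℕ (suc K) h = trans (fromℕ-+ (h Fin.zero) _) (+-congˡ (fromℕ-sumℕ K (h ∘ Fin.suc)))

  module Alpha {n : ℕ} (Γ : WDigraph R n) where

    powers : ∀ K → Vector ℕ K → Carrier
    powers K p = prodR R K (λ t → pow R (σ R Γ (suc (toℕ t))) (p t))

    powers-updateAt-pred : ∀ {K} (p : Vector ℕ (suc K)) t {v} → p t ≡ suc v →
      powers (suc K) p ≈ σ R Γ (suc (toℕ t)) * powers (suc K) (Vec.updateAt p t ℕ.pred)
    powers-updateAt-pred {K} p t {v} p-t = begin
      powers (suc K) p
        ≈⟨ prodR-remove K (λ c → σᵖ c (p c)) t ⟩
      σᵖ t (p t) * prodR R K (λ c → σᵖ (punchIn t c) (p (punchIn t c)))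
        ≈⟨ *-cong (reflexive (≡.cong (σᵖ t) p-t))
                  (prodR-cong K (λ c → reflexive (≡.cong (σᵖ (punchIn t c)) (≡.sym (p⁻-other c))))) ⟩
      (σ R Γ (suc (toℕ t)) * σᵖ t v) * prodR R K (λ c → σᵖ (punchIn t c) (p⁻ (punchIn t c)))
        ≈⟨ *-assoc _ _ _ ⟩
      σ R Γ (suc (toℕ t)) * (σᵖ t v * prodR R K (λ c → σᵖ (punchIn t c) (p⁻ (punchIn t c))))
        ≈⟨ *-congˡ (*-congʳ (reflexive (≡.cong (σᵖ t) p⁻-t))) ⟨
      σ R Γ (suc (toℕ t)) * (σᵖ t (p⁻ t) * prodR R K (λ c → σᵖ (punchIn t c) (p⁻ (punchIn t c))))
        ≈⟨ *-congˡ (prodR-remove K (λ c → σᵖ c (p⁻ c)) t) ⟨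
      σ R Γ (suc (toℕ t)) * powers (suc K) p⁻
        ∎
      where
      σᵖ : Fin (suc K) → ℕ → Carrier
      σᵖ c = pow R (σ R Γ (suc (toℕ c)))
      p⁻ = Vec.updateAt p t ℕ.pred
      p⁻-t : p⁻ t ≡ v
      p⁻-t = ≡.trans (Vecₚ.updateAt-updates t p) (≡.cong ℕ.pred p-t)
      p⁻-other : ∀ c → p⁻ (punchIn t c) ≡ p (punchIn t c)
      p⁻-other c = Vecₚ.updateAt-minimal (punchIn t c) t p (Finₚ.punchInᵢ≢i t c)

    αterm⁻ : ∀ K → Fin K → Vector ℕ K → Carrier
    αterm⁻ K t p = if p t ℕ.≡ᵇ 0 then 0# else αterm R Γ K (Vec.updateAt p t ℕ.pred)

    αterm-pascal : ∀ K (p : Vector ℕ K) s → sumℕ K p ≡ suc s →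
      αterm R Γ K p ≈ ∑[ t < K ] (- σ R Γ (suc (toℕ t)) * αterm⁻ K t p)
    αterm-pascal (suc K) p s Σp≡1+s = begin
      (sign p * fromℕ R (multinomial (suc K) p)) * powers (suc K) p
        ≈⟨ *-congʳ (*-congˡ (trans (reflexive (≡.cong (fromℕ R) (multinomial-pascal (suc K) p s Σp≡1+s)))
                                   (fromℕ-sumℕ (suc K) M⁻))) ⟩
      (sign p * ∑[ t < suc K ] fromℕ R (M⁻ t)) * powers (suc K) p
        ≈⟨ trans (*-congʳ (*-distribˡ-sum (sign p) (fromℕ R ∘ M⁻)))
                 (*-distribʳ-sum (powers (suc K) p) (λ t → sign p * fromℕ R (M⁻ t))) ⟩
      ∑[ t < suc K ] ((sign p * fromℕ R (M⁻ t)) * powers (suc K) p)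
        ≈⟨ sum-cong-≋ (λ t → term t (p t) refl) ⟩
      ∑[ t < suc K ] (- σ R Γ (suc (toℕ t)) * αterm⁻ (suc K) t p) ∎
      where
      sign : Vector ℕ (suc K) → Carrier
      sign q = pow R (- 1#) (sumℕ (suc K) q)
      M⁻ : Vector ℕ (suc K)
      M⁻ t = if p t ℕ.≡ᵇ 0 then 0 else multinomial (suc K) (Vec.updateAt p t ℕ.pred)
      term : ∀ t x → p t ≡ x →
        (sign p * fromℕ R (M⁻ t)) * powers (suc K) p ≈ - σ R Γ (suc (toℕ t)) * αterm⁻ (suc K) t p
      term t ℕ.zero    p-t rewrite p-t = trans (trans (*-congʳ (zeroʳ _)) (zeroˡ _)) (sym (zeroʳ _))
      term t (suc v) p-t rewrite p-t = begin
        (sign p * fromℕ R M) * powers (suc K) p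
          ≈⟨ *-cong (*-congʳ (reflexive (≡.cong (pow R (- 1#)) (sumℕ-updateAt-pred p t p-t))))
                    (powers-updateAt-pred p t p-t) ⟩
        ((- 1# * sign p⁻) * fromℕ R M) * (σ R Γ (suc (toℕ t)) * powers (suc K) p⁻)
          ≈⟨ solve 5 (λ m x mm s d → ((m :* x) :* mm) :* (s :* d) := m :* (s :* ((x :* mm) :* d))) ≈-refl
                   (- 1#) (sign p⁻) (fromℕ R M) (σ R Γ (suc (toℕ t))) (powers (suc K) p⁻) ⟩
        - 1# * (σ R Γ (suc (toℕ t)) * αterm R Γ (suc K) p⁻)
          ≈⟨ trans (sym (*-assoc _ _ _)) (*-congʳ (-1*x≈-x _)) ⟩
        - σ R Γ (suc (toℕ t)) * αterm R Γ (suc K) p⁻ ∎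
        where
        p⁻ = Vec.updateAt p t ℕ.pred
        M = multinomial (suc K) p⁻

    αterm-resp : ∀ K → RespectsPointwise (αterm R Γ K)
    αterm-resp K {p} {q} e =
      *-cong (*-cong (reflexive (≡.cong (pow R (- 1#)) (sumℕ-cong K e))) (reflexive (≡.cong (fromℕ R) (multinomial-cong K e))))
             (prodR-cong K (λ t → reflexive (≡.cong (pow R (σ R Γ (suc (toℕ t)))) (e t))))

    powers-pad : ∀ k d (q : Vector ℕ k) → powers (k ℕ.+ d) (pad k q) ≈ powers k q
    powers-pad k d q = go k d (λ c → σ R Γ (suc c)) q
      where
      go : ∀ k d (s : ℕ → Carrier) (q : Vector ℕ k) →
        prodR R (k ℕ.+ d) (λ c → pow R (s (toℕ c)) (pad k q c)) ≈ prodR R k (λ c → pow R (s (toℕ c)) (q c))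
      go ℕ.zero    ℕ.zero    s q = ≈-refl
      go ℕ.zero    (suc d) s q = trans (*-identityˡ _) (go 0 d (s ∘ suc) q)
      go (suc k) d s q = *-congˡ (go k d (s ∘ suc) (q ∘ Fin.suc))

    αterm-pad : ∀ k d (q : Vector ℕ k) → αterm R Γ (k ℕ.+ d) (pad k q) ≈ αterm R Γ k q
    αterm-pad k d q = *-cong (*-cong (reflexive (≡.cong (pow R (- 1#)) (sumℕ-pad k d (λ _ x → x) q (λ _ → refl))))
                                     (reflexive (≡.cong (fromℕ R) (multinomial-pad k d q))))
                             (powers-pad k d q)

    αsummand : ∀ K → ℕ → Vector ℕ K → Carrier
    αsummand K w p = if partitionSize K p ℕ.≡ᵇ w then αterm R Γ K p else 0#

    αsummand-resp : ∀ K w → RespectsPointwise (αsummand K w)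
    αsummand-resp K w e = if-cong (≡.cong (ℕ._≡ᵇ w) (partitionSize-cong K e)) (αterm-resp K e)

    αsummand-large : ∀ K w p → w ℕ.< partitionSize K p → αsummand K w p ≈ 0#
    αsummand-large K w p w<size with partitionSize K p ℕ.≡ᵇ w in eq
    ... | false = ≈-refl
    ... | true  = ⊥-elim (ℕₚ.<-irrefl (≡.sym (ℕₚ.≡ᵇ⇒≡ _ w (≡⇒T eq))) w<size)

    α≈sumFun : ∀ w → α R Γ w ≈ sumFun (upTo (suc w)) w (αsummand w w)
    α≈sumFun ℕ.zero    = sym (trans (*-identityʳ _) (trans (*-identityˡ _) (+-identityʳ _)))
    α≈sumFun (suc w) = trans (sumMap-filterᵇ _ (allFuns (upTo (suc (suc w))) (suc w)) (αterm R Γ (suc w)))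
                             (sumMap-allFuns (upTo (suc (suc w))) (suc w) (αsummand-resp (suc w) (suc w)))

    -- Larger entries, and nonzero entries beyond index w, are excluded by partitionSize p ≡ w.
    α≈sumFun-padded : ∀ w d → α R Γ w ≈ sumFun (upTo (suc (w ℕ.+ d))) (w ℕ.+ d) (αsummand (w ℕ.+ d) w)
    α≈sumFun-padded w d = begin
      α R Γ w
        ≈⟨ α≈sumFun w ⟩
      sumFun (upTo (suc w)) w (αsummand w w)
        ≈⟨ sumFun-cong (upTo (suc w)) w unpad ⟨
      sumFun (upTo (suc w)) w (αsummand K w ∘ pad w)
        ≈⟨ sumFun-pad w w d (αsummand K w) (αsummand-resp K w) padding-zero ⟨
      sumFun (upTo (suc w)) K (αsummand K w)
        ≈⟨ sumFun-upTo-+ d (suc w) K (αsummand K w) entries≤w ⟨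
      sumFun (upTo (d ℕ.+ suc w)) K (αsummand K w)
        ≡⟨ ≡.cong (λ B → sumFun (upTo B) K (αsummand K w)) (≡.trans (ℕₚ.+-suc d w) (≡.cong suc (ℕₚ.+-comm d w))) ⟩
      sumFun (upTo (suc (w ℕ.+ d))) K (αsummand K w)
        ∎
      where
      K = w ℕ.+ d
      unpad : ∀ q → αsummand K w (pad w q) ≈ αsummand w w q
      unpad q = if-cong (≡.cong (ℕ._≡ᵇ w) (partitionSize-pad w d q)) (αterm-pad w d q)
      entries≤w : ∀ p c → suc w ≤ p c → αsummand K w p ≈ 0#
      entries≤w p c w<pc = αsummand-large K w p
        (ℕₚ.<-≤-trans w<pc (ℕₚ.≤-trans (ℕₚ.m≤n*m (p c) (suc (toℕ c))) (part≤partitionSize K p c)))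
      padding-zero : ∀ p c → p (w Fin.↑ʳ c) ≢ 0 → αsummand K w p ≈ 0#
      padding-zero p c pc≢0 = αsummand-large K w p
        (ℕₚ.<-≤-trans (big (p (w Fin.↑ʳ c)) pc≢0) (part≤partitionSize K p (w Fin.↑ʳ c)))
        where
        big : ∀ v → v ≢ 0 → w ℕ.< suc (toℕ (w Fin.↑ʳ c)) ℕ.* v
        big ℕ.zero    v≢0 = ⊥-elim (v≢0 refl)
        big (suc v) _   = ℕₚ.<-≤-trans (ℕ.s≤s (≡.subst (w ≤_) (≡.sym (Finₚ.toℕ-↑ʳ w c)) (ℕₚ.m≤m+n w (toℕ c))))
                                        (ℕₚ.m≤m*n (suc (toℕ (w Fin.↑ʳ c))) (suc v))

    αsummand⁻ : ∀ K → Fin K → Vector ℕ K → Carrier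
    αsummand⁻ K t p = if partitionSize K p ℕ.≡ᵇ K then αterm⁻ K t p else 0#

    αsummand⁻-insert-suc : ∀ m (t : Fin (suc m)) v p′ →
      αsummand⁻ (suc m) t (insert t (suc v) p′) ≈ αsummand (suc m) (m ∸ toℕ t) (insert t v p′)
    αsummand⁻-insert-suc m t v p′ rewrite insert-at t (suc v) p′ =
      if-cong (≡.trans (≡.cong (ℕ._≡ᵇ suc m) (partitionSize-insert-suc m t v p′))
                       (+-≡ᵇ (partitionSize (suc m) (insert t v p′)) (Finₚ.toℕ<n t)))
              (αterm-resp (suc m) (updateAt-insert t (suc v) ℕ.pred p′))

    sumFun-αsummand⁻ : ∀ m (t : Fin (suc m)) →
      sumFun (upTo (suc (suc m))) (suc m) (αsummand⁻ (suc m) t)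
        ≈ sumFun (upTo (suc (suc m))) (suc m) (αsummand (suc m) (m ∸ toℕ t))
    sumFun-αsummand⁻ m t = begin
      sumFun vals K (αsummand⁻ K t)
        ≈⟨ sumFun-insert vals m t (αsummand⁻ K t) ⟩
      sumMap (λ v → ΣF (αsummand⁻ K t) v) (upTo (suc K))
        ≈⟨ sumMap-upTo-first _ K ⟩
      ΣF (αsummand⁻ K t) 0 + sumMap (λ v → ΣF (αsummand⁻ K t) (suc v)) (upTo K)
        ≈⟨ +-cong (sumFun-zero vals m no-part) (sumMap-cong (upTo K) (λ v → sumFun-cong vals m (αsummand⁻-insert-suc m t v))) ⟩
      0# + sumMap (λ v → ΣF (αsummand K K′) v) (upTo K)
        ≈⟨ trans (+-identityˡ _) (sym (trans (+-congˡ (sumFun-zero vals m too-many)) (+-identityʳ _))) ⟩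
      sumMap (λ v → ΣF (αsummand K K′) v) (upTo K) + ΣF (αsummand K K′) K
        ≈⟨ sumMap-upTo-last _ K ⟨
      sumMap (λ v → ΣF (αsummand K K′) v) (upTo (suc K))
        ≈⟨ sumFun-insert vals m t (αsummand K K′) ⟨
      sumFun vals K (αsummand K K′) ∎
      where
      K = suc m
      K′ = m ∸ toℕ t
      vals = upTo (suc K)
      ΣF : (Vector ℕ K → Carrier) → ℕ → Carrier
      ΣF ψ v = sumFun vals m (λ p′ → ψ (insert t v p′))
      no-part : ∀ p′ → αsummand⁻ K t (insert t 0 p′) ≈ 0#
      no-part p′ rewrite insert-at t 0 p′ with partitionSize K (insert t 0 p′) ℕ.≡ᵇ K
      ... | true  = ≈-refl
      ... | false = ≈-refl
      too-many : ∀ p′ → αsummand K K′ (insert t K p′) ≈ 0#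
      too-many p′ = αsummand-large K K′ (insert t K p′) (ℕₚ.<-≤-trans (ℕ.s≤s (ℕₚ.m∸n≤m m (toℕ t)))
        (ℕₚ.≤-trans (ℕₚ.m≤n*m K (suc (toℕ t)))
                    (≡.subst (λ x → suc (toℕ t) ℕ.* x ≤ partitionSize K (insert t K p′)) (insert-at t K p′)
                             (part≤partitionSize K (insert t K p′) t))))

    αsummand-pascal : ∀ m (p : Vector ℕ (suc m)) →
      αsummand (suc m) (suc m) p ≈ ∑[ t < suc m ] (- σ R Γ (suc (toℕ t)) * αsummand⁻ (suc m) t p)
    αsummand-pascal m p = by-size (partitionSize K p ℕ.≡ᵇ K) refl
      where
      K = suc m
      nonempty : ∀ x → sumℕ K p ≡ x → partitionSize K p ≡ K →
        αterm R Γ K p ≈ ∑[ t < K ] (- σ R Γ (suc (toℕ t)) * αterm⁻ K t p)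
      nonempty (suc s) Σp _      = αterm-pascal K p s Σp
      nonempty ℕ.zero  Σp size≡K with () ← ≡.trans (≡.sym size≡K)
        (sumℕ-zero K (λ i → ≡.trans (≡.cong (suc (toℕ i) ℕ.*_) (sumℕ-zero⁻ K p Σp i)) (ℕₚ.*-zeroʳ (suc (toℕ i)))))
      by-size : ∀ b → (partitionSize K p ℕ.≡ᵇ K) ≡ b →
        (if b then αterm R Γ K p else 0#) ≈ ∑[ t < K ] (- σ R Γ (suc (toℕ t)) * (if b then αterm⁻ K t p else 0#))
      by-size true  size≡K = nonempty (sumℕ K p) refl (ℕₚ.≡ᵇ⇒≡ _ K (≡⇒T size≡K))
      by-size false _      = sym (∑-zero K (λ t → zeroʳ (- σ R Γ (suc (toℕ t)))))

    α≈sumFun-∸ : ∀ m (t : Fin (suc m)) → α R Γ (m ∸ toℕ t) ≈ sumFun (upTo (suc (suc m))) (suc m) (αsummand (suc m) (m ∸ toℕ t))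
    α≈sumFun-∸ m t = ≡.subst (λ K → α R Γ (m ∸ toℕ t) ≈ sumFun (upTo (suc K)) K (αsummand K (m ∸ toℕ t)))
                             (≡.trans (ℕₚ.+-suc (m ∸ toℕ t) (toℕ t)) (≡.cong suc (ℕₚ.m∸n+n≡m (Finₚ.toℕ≤pred[n] t))))
                             (α≈sumFun-padded (m ∸ toℕ t) (suc (toℕ t)))

    α-recurrence : ∀ m → α R Γ (suc m) ≈ - ∑[ k < suc m ] (α R Γ (toℕ k) * σ R Γ (suc m ∸ toℕ k))
    α-recurrence m = begin
      α R Γ K
        ≈⟨ α≈sumFun K ⟩
      sumFun vals K (αsummand K K)
        ≈⟨ sumFun-cong vals K (αsummand-pascal m) ⟩
      sumFun vals K (λ p → ∑[ t < K ] (- σ′ t * αsummand⁻ K t p))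
        ≈⟨ sumFun-∑-comm vals K K (λ p t → - σ′ t * αsummand⁻ K t p) ⟩
      ∑[ t < K ] sumFun vals K (λ p → - σ′ t * αsummand⁻ K t p)
        ≈⟨ sum-cong-≋ {K} (λ t → sym (*-distribˡ-sumFun vals K (- σ′ t) (αsummand⁻ K t))) ⟩
      ∑[ t < K ] (- σ′ t * sumFun vals K (αsummand⁻ K t))
        ≈⟨ sum-cong-≋ {K} (λ t → *-congˡ {x = - σ′ t} (trans (sumFun-αsummand⁻ m t) (sym (α≈sumFun-∸ m t)))) ⟩
      ∑[ t < K ] (- σ′ t * α R Γ (m ∸ toℕ t))
        ≈⟨ sum-cong-≋ {K} (λ t → -‿distribˡ-* (σ′ t) (α R Γ (m ∸ toℕ t))) ⟨
      ∑[ t < K ] (- (σ′ t * α R Γ (m ∸ toℕ t)))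
        ≈⟨ ∑-neg K (λ t → σ′ t * α R Γ (m ∸ toℕ t)) ⟩
      - ∑[ t < K ] (σ′ t * α R Γ (m ∸ toℕ t))
        ≈⟨ -‿cong (trans (∑-reverse m (λ x → σ R Γ (suc x) * α R Γ (m ∸ x))) (sum-cong-≋ {K} reindex)) ⟩
      - ∑[ k < K ] (α R Γ (toℕ k) * σ R Γ (K ∸ toℕ k)) ∎
      where
      K = suc m
      vals = upTo (suc K)
      σ′ : Fin K → Carrier
      σ′ t = σ R Γ (suc (toℕ t))
      reindex : ∀ k → σ R Γ (suc (m ∸ toℕ k)) * α R Γ (m ∸ (m ∸ toℕ k)) ≈ α R Γ (toℕ k) * σ R Γ (K ∸ toℕ k)
      reindex k = trans (*-cong (reflexive (≡.cong (σ R Γ) (≡.sym (ℕₚ.+-∸-assoc 1 k≤m))))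
                                (reflexive (≡.cong (α R Γ) (ℕₚ.m∸[m∸n]≡n k≤m))))
                        (*-comm (σ R Γ (K ∸ toℕ k)) (α R Γ (toℕ k)))
        where k≤m = Finₚ.toℕ≤pred[n] k

proposition8 : ∀ {c ℓ} (R : CommutativeRing c ℓ) (n : ℕ) → 2 ≤ n → (Γ : WDigraph R n) →
    ∀ (m : ℕ) (i j : Fin n) →
      CommutativeRing._≈_ R (powM R (negM R (laplacian R Γ)) m i j)
        (sumR R (suc m) (λ k → CommutativeRing._*_ R (α R Γ (toℕ k)) (Q R Γ (m ∸ toℕ k) i j)))
proposition8 R n _ Γ m i j = trans
  (powM-expansion R (negM R (laplacian R Γ)) (σ R Γ) (α R Γ) (Q R Γ) (Q-zero R Γ) (Q-recurrence R Γ) ≈-refl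
                  (Alpha.α-recurrence R Γ) m i j)
  (reflexive (≡.sym (sumR≡∑ R (suc m) (λ k → α R Γ (toℕ k) * Q R Γ (m ∸ toℕ k) i j))))
  where open CommutativeRing R renaming (refl to ≈-refl)
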